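{- Let $G$ be a connected (bull, diamond)-free graph with clique number $\omega=\omega(G)>2$, and let $K=\{v_1,v_2,\dots,v_\omega\}$ induce a maximum clique in $G$. Then either $G$ is isomorphic to a subgraph of $K_\omega \square K_2$, or all of the following hold: (i) There exist $i,j\in\{1,\dots,\omega\}$ such that $N_1(K)=W_K(i)\cup W_K(j)$. Moreover, if $N_1(K)=W_K(i)$ or $N_1(K)=W_K(j)$, then $G[N_1(K)]$ is a disjoint union of cliques; otherwise $G[N_1(K)]$ is a complete bipartite graph with bipartition $(W_K(i),W_K(j))$. (ii) For every $i>1$, $G[N_i(K)]$ is a disjoint union of complete graphs and triangle-free graphs (i.e., each component of $G[N_i(K)]$ is a complete graph or triangle-free). (iii) If $G'$ is a component of $G[N_i(K)]$ for some $i>1$ and $G'$ contains a triangle, then no vertex of $G'$ has a neighbour in $N_{i+1}(K)$. (iv) Let $i\ge 2$ and let $G'$ be a component of $G[N_i(K)]$ that contains a triangle. If $G[K\cup N_1(K)\cup\dots\cup N_{i-1}(K)]$ is $k$-colorable, then $G[K\cup N_1(K)\cup\dots\cup N_{i-1}(K)\cup V(G')]$ is $k$-colorable.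
   Context: All graphs are finite, simple, undirected. A bull is the graph obtained from a triangle by adding two pendant edges at two different vertices of the triangle. A diamond is $K_4$ minus one edge. A graph is $\mathcal{F}$-free if it contains no member of $\mathcal{F}$ as an induced subgraph. $\omega(G)$ is the clique number. For $S\subseteq V(G)$, $G[S]$ is the induced subgraph. For a clique $K=\{v_1,\dots,v_\omega\}$: $W_K(i)=\{x\in V(G)\setminus K : N(x)\cap K=\{v_i\}\}$ and $N_i(K)=\{x\in V(G): d_G(x,K)=i\}$, where $d_G(x,K)=\min_{u\in K} d_G(x,u)$. $G\square H$ denotes the Cartesian product: vertex set $V(G)\times V(H)$, with $(a,u)\sim(b,v)$ iff ($a=b$ and $uv\in E(H)$) or ($u=v$ and $ab\in E(G)$). A $k$-coloring is a proper vertex coloring with $k$ colors. -}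

module Defs where

open import Data.Nat using (ℕ; zero; suc; _<_)
open import Data.Fin using (Fin) renaming (zero to f0; suc to fs)
import Data.Fin as F
open import Data.Bool using (Bool; true; false; T)
open import Data.Product using (Σ; ∃; _×_; _,_)
open import Data.Sum using (_⊎_; inj₁; inj₂)
open import Relation.Nullary using (¬_; Dec; yes; no)
open import Relation.Nullary.Decidable using (_×-dec_; _⊎-dec_; ¬?)
open import Relation.Binary.PropositionalEquality using (_≡_; _≢_; refl)
import Relation.Binary.PropositionalEquality as Eq
open import Function.Definitions using (Injective)
open import Function.Bundles using (_⇔_)

record Graph (V : Set) : Set₁ where
  field
    E      : V → V → Set
    sym    : ∀ {x y} → E x y → E y x
    irrefl : ∀ {x} → ¬ E x x
    dec    : ∀ x y → Dec (E x y)
open Graph public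

Kc : (m : ℕ) → Graph (Fin m)
Kc m = record
  { E = λ a b → a ≢ b
  ; sym = λ p q → p (Eq.sym q)
  ; irrefl = λ p → p refl
  ; dec = λ a b → ¬? (a F.≟ b)
  }

_□_ : ∀ {m k} → Graph (Fin m) → Graph (Fin k) → Graph (Fin m × Fin k)
_□_ {m} {k} G H = record { E = e ; sym = s ; irrefl = i ; dec = d }
  where
  e : Fin m × Fin k → Fin m × Fin k → Set
  e (a , u) (b , v) = (a ≡ b × E H u v) ⊎ (u ≡ v × E G a b)
  s : ∀ {x y} → e x y → e y x
  s (inj₁ (refl , h)) = inj₁ (refl , sym H h)
  s (inj₂ (refl , g)) = inj₂ (refl , sym G g)
  i : ∀ {x} → ¬ e x x
  i (inj₁ (_ , h)) = irrefl H h
  i (inj₂ (_ , g)) = irrefl G g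
  d : ∀ x y → Dec (e x y)
  d (a , u) (b , v) = ((a F.≟ b) ×-dec dec H u v) ⊎-dec ((u F.≟ v) ×-dec dec G a b)

IsoToSubgraphOf : ∀ {V W} → Graph V → Graph W → Set
IsoToSubgraphOf {V} {W} G H =
  Σ (V → W) λ f → Injective _≡_ _≡_ f × (∀ x y → E G x y → E H (f x) (f y))

ContainsInduced : ∀ {V} → Graph V → (k : ℕ) → (Fin k → Fin k → Bool) → Set
ContainsInduced {V} G k h =
  Σ (Fin k → V) λ f → Injective _≡_ _≡_ f × (∀ a b → E G (f a) (f b) ⇔ T (h a b))

-- bull: triangle 0,1,2 with pendant edges 0-3 and 1-4
bullAdj : Fin 5 → Fin 5 → Bool
bullAdj f0 (fs f0) = true
bullAdj (fs f0) f0 = true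
bullAdj f0 (fs (fs f0)) = true
bullAdj (fs (fs f0)) f0 = true
bullAdj (fs f0) (fs (fs f0)) = true
bullAdj (fs (fs f0)) (fs f0) = true
bullAdj f0 (fs (fs (fs f0))) = true
bullAdj (fs (fs (fs f0))) f0 = true
bullAdj (fs f0) (fs (fs (fs (fs f0)))) = true
bullAdj (fs (fs (fs (fs f0)))) (fs f0) = true
bullAdj _ _ = false

-- diamond: K_4 on 0,1,2,3 minus the edge 2-3
diamondAdj : Fin 4 → Fin 4 → Bool
diamondAdj f0 (fs f0) = true
diamondAdj (fs f0) f0 = true
diamondAdj f0 (fs (fs f0)) = true
diamondAdj (fs (fs f0)) f0 = true
diamondAdj f0 (fs (fs (fs f0))) = true
diamondAdj (fs (fs (fs f0))) f0 = true
diamondAdj (fs f0) (fs (fs f0)) = true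
diamondAdj (fs (fs f0)) (fs f0) = true
diamondAdj (fs f0) (fs (fs (fs f0))) = true
diamondAdj (fs (fs (fs f0))) (fs f0) = true
diamondAdj _ _ = false

BullFree : ∀ {V} → Graph V → Set
BullFree G = ¬ ContainsInduced G 5 bullAdj

DiamondFree : ∀ {V} → Graph V → Set
DiamondFree G = ¬ ContainsInduced G 4 diamondAdj

data Walk {V} (G : Graph V) : V → V → ℕ → Set where
  here : ∀ x → Walk G x x 0
  step : ∀ {x y z m} → E G x y → Walk G y z m → Walk G x z (suc m)

Connected : ∀ {V} → Graph V → Set
Connected G = ∀ x y → ∃ λ m → Walk G x y m

IsClique : ∀ {V} → Graph V → {m : ℕ} → (Fin m → V) → Set
IsClique G v = Injective _≡_ _≡_ v × (∀ a b → a ≢ b → E G (v a) (v b))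

IsMaxClique : ∀ {V} → Graph V → {ω : ℕ} → (Fin ω → V) → Set
IsMaxClique {V} G {ω} v = IsClique G v × (∀ (u : Fin (suc ω) → V) → ¬ IsClique G u)

module _ {V : Set} (G : Graph V) {ω : ℕ} (v : Fin ω → V) where

  InK : V → Set
  InK x = ∃ λ a → v a ≡ x

  W : Fin ω → V → Set
  W i x = ¬ InK x × E G x (v i) × (∀ a → E G x (v a) → a ≡ i)

  DistK : V → ℕ → Set
  DistK x m = (∃ λ a → Walk G x (v a) m)
            × (∀ m' → m' < m → ∀ a → ¬ Walk G x (v a) m')

  Nb : ℕ → V → Set
  Nb i x = DistK x i

SetEq : ∀ {V : Set} → (V → Set) → (V → Set) → Set
SetEq A B = ∀ x → A x ⇔ B x

data ReachIn {V} (G : Graph V) (S : V → Set) : V → V → Set where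
  base : ∀ {x} → S x → ReachIn G S x x
  step : ∀ {x y z} → S x → E G x y → ReachIn G S y z → ReachIn G S x z

IsComponent : ∀ {V} → Graph V → (V → Set) → (V → Set) → Set
IsComponent G S C = ∃ λ x₀ → S x₀ × SetEq C (ReachIn G S x₀)

IsCompleteOn : ∀ {V} → Graph V → (V → Set) → Set
IsCompleteOn G C = ∀ x y → C x → C y → x ≢ y → E G x y

HasTriangle : ∀ {V} → Graph V → (V → Set) → Set
HasTriangle G C = ∃ λ x → ∃ λ y → ∃ λ z →
  C x × C y × C z × E G x y × E G y z × E G x z

TriangleFreeOn : ∀ {V} → Graph V → (V → Set) → Set
TriangleFreeOn G C = ¬ HasTriangle G C

DisjointUnionOfCliques : ∀ {V} → Graph V → (V → Set) → Set₁
DisjointUnionOfCliques G S = ∀ C → IsComponent G S C → IsCompleteOn G C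

CompleteBipartite : ∀ {V} → Graph V → (V → Set) → (V → Set) → (V → Set) → Set
CompleteBipartite G S A B =
  SetEq S (λ x → A x ⊎ B x)
  × (∀ x → ¬ (A x × B x))
  × (∀ x y → S x → S y → E G x y ⇔ ((A x × B y) ⊎ (B x × A y)))

Colorable : ∀ {V} → Graph V → (V → Set) → ℕ → Set
Colorable {V} G S k =
  Σ (V → Fin k) λ c → ∀ x y → S x → S y → E G x y → c x ≢ c y

module Submission where

-- A vertex outside the maximum clique K sees at most one vertex of K: two would
-- give a diamond, all of them a larger clique.  So N₁(K) is the union of the
-- classes W_K(a), and vertices of different classes are adjacent, since
-- otherwise they form a bull with a third vertex of K.  If three classes are
-- occupied, each is a single vertex, N₁(K) ∪ N₂(K) is a clique and N₃(K) is
-- empty; colouring N₁ ∪ N₂ greedily, starting from the class index on N₁,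
-- embeds G into K_ω □ K₂.  Otherwise at most two classes are occupied, each
-- class is P₃-free, and (i) follows.
--
-- On a level N_i(K) with i ≥ 2 every triangle has a common neighbour one level
-- down, and bull- and diamond-freeness then force every vertex of N_i(K)
-- adjacent to a triangle to see all of it.  Hence a component containing a
-- triangle is a clique (ii) without neighbours on the next level (iii).  For
-- (iv), a vertex one level down that sees two vertices of this clique C sees
-- all of it, and such full vertices are pairwise adjacent; the vertices that
-- see exactly one vertex of C all see the same vertex x.  That vertex can reuse
-- the colour of a suitable vertex t two levels down, and the rest of C is
-- coloured greedily, because its neighbours below are all full.

open import Defs
open import Data.Nat using (ℕ; zero; suc; _+_; _≤_; _<_; z≤n; s≤s)
open import Data.Nat.Properties
  using (≮⇒≥; n≤1+n; ≤-refl; ≤-antisym; +-comm; ≤-trans; ≤-pred; ≤∧≢⇒<; <-cmp; m≤n⇒m≤1+n)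
  renaming (<⇒≢ to <⇒≢ℕ)
open import Data.Nat.Induction using (<-rec)
import Data.Nat as ℕ
open import Data.Fin using (Fin; inject≤; fromℕ<) renaming (zero to f0; suc to fs)
open import Data.Fin.Properties
  using (any?; all?; 0≢1+n; pigeonhole; inject≤-injective; <⇒≢) renaming (_≟_ to _≟ᶠ_)
open import Data.Bool using (Bool; true; false; T)
import Data.Bool as Bool
open import Data.Product using (Σ; ∃; _×_; _,_; proj₁; proj₂)
open import Data.Product.Properties using (≡-dec)
open import Data.Sum using (_⊎_; inj₁; inj₂; [_,_]′; reduce; swap)
open import Data.Empty using (⊥; ⊥-elim)
open import Data.Unit using (⊤; tt)
open import Relation.Nullary using (¬_; Dec; yes; no)
open import Relation.Nullary.Decidable using (_⊎-dec_; _×-dec_; _→-dec_; ¬?; toWitness; map′; decidable-stable)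
open import Relation.Binary.Definitions using (DecidableEquality; tri<; tri≈; tri>)
open import Relation.Binary.PropositionalEquality using (_≡_; _≢_; refl; subst; cong; trans) renaming (sym to ≡-sym)
open import Function.Bundles using (_⇔_; mk⇔; Equivalence)
open import Data.List using (List; []; _∷_; allFin)
open import Data.List.Membership.Propositional using (_∈_)
open import Data.List.Membership.Propositional.Properties using (∈-allFin)
open import Data.List.Relation.Unary.Any using (here; there)
import Data.List.Membership.DecPropositional as DecMembership
open import Data.Vec.Functional using () renaming (_∷_ to _◂_)
open import Function.Definitions using (Injective)
open import Function.Base using (_∘_)
open import Function.Construct.Composition using (_⇔-∘_)
open import Function.Construct.Symmetry using (⇔-sym)

T-injective : ∀ {x y} → T x ⇔ T y → x ≡ y
T-injective {false} {false} _ = refl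
T-injective {false} {true} x⇔y = ⊥-elim (Equivalence.from x⇔y tt)
T-injective {true} {false} x⇔y = ⊥-elim (Equivalence.to x⇔y tt)
T-injective {true} {true} _ = refl

avoid-two : ∀ {A : Set} → DecidableEquality A → (P : A → Set) {p q s : A} → P p → P q → P s
  → p ≢ q → p ≢ s → q ≢ s → (x y : A) → ∃ λ z → P z × z ≢ x × z ≢ y
avoid-two _≟_ P {p} {q} {s} Pp Pq Ps p≢q p≢s q≢s x y with hits p | hits q | hits s
  where
  hits : ∀ z → Dec (z ≡ x ⊎ z ≡ y)
  hits z = (z ≟ x) ⊎-dec (z ≟ y)
... | no miss | _ | _ = p , Pp , miss ∘ inj₁ , miss ∘ inj₂
... | yes _ | no miss | _ = q , Pq , miss ∘ inj₁ , miss ∘ inj₂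
... | yes _ | yes _ | no miss = s , Ps , miss ∘ inj₁ , miss ∘ inj₂
... | yes hp | yes hq | yes hs = ⊥-elim (two-of-three hp hq hs)
  where
  two-of-three : (p ≡ x ⊎ p ≡ y) → (q ≡ x ⊎ q ≡ y) → (s ≡ x ⊎ s ≡ y) → ⊥
  two-of-three (inj₁ a) (inj₁ b) _ = p≢q (trans a (≡-sym b))
  two-of-three (inj₂ a) (inj₂ b) _ = p≢q (trans a (≡-sym b))
  two-of-three (inj₁ a) _ (inj₁ b) = p≢s (trans a (≡-sym b))
  two-of-three (inj₂ a) _ (inj₂ b) = p≢s (trans a (≡-sym b))
  two-of-three _ (inj₁ a) (inj₁ b) = q≢s (trans a (≡-sym b))
  two-of-three _ (inj₂ a) (inj₂ b) = q≢s (trans a (≡-sym b))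

other-index : ∀ {ω} → 2 < ω → (a b : Fin ω) → ∃ λ c → c ≢ a × c ≢ b
other-index (s≤s (s≤s (s≤s _))) a b
  with avoid-two _≟ᶠ_ (λ _ → ⊤) {f0} {fs f0} {fs (fs f0)} tt tt tt (λ ()) (λ ()) (λ ()) a b
... | c , _ , c≢a , c≢b = c , c≢a , c≢b

Twins : ∀ {k} → (Fin k → Fin k → Bool) → Fin k → Fin k → Set
Twins h a b = ∀ c → h a c ≡ h b c

bull-twin-free : ∀ a b → Twins bullAdj a b → a ≡ b
bull-twin-free = toWitness {a? = all? λ a → all? λ b →
  all? (λ c → bullAdj a c Bool.≟ bullAdj b c) →-dec (a ≟ᶠ b)} _

-- The two vertices of degree two of the diamond are twins, which is why no-diamond needs c ≢ d.
diamond-twins : ∀ a b → Twins diamondAdj a b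
  → a ≡ b ⊎ (a , b) ≡ (fs (fs f0) , fs (fs (fs f0))) ⊎ (a , b) ≡ (fs (fs (fs f0)) , fs (fs f0))
diamond-twins = toWitness {a? = all? λ a → all? λ b →
  all? (λ c → diamondAdj a c Bool.≟ diamondAdj b c)
    →-dec ((a ≟ᶠ b) ⊎-dec ≡-dec _≟ᶠ_ _≟ᶠ_ (a , b) _ ⊎-dec ≡-dec _≟ᶠ_ _≟ᶠ_ (a , b) _)} _

module _ {n : ℕ} (G : Graph (Fin n)) where

  open DecMembership (_≟ᶠ_ {n}) using (_∈?_)

  infix 4 _~_
  _~_ : Fin n → Fin n → Set
  _~_ = E G

  ~-sym : ∀ {x y} → x ~ y → y ~ x
  ~-sym = sym G

  ~⇒≢ : ∀ {x y} → x ~ y → x ≢ y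
  ~⇒≢ e refl = irrefl G e

  edge : ∀ {x y} → x ~ y → x ~ y ⇔ T true
  edge e = mk⇔ (λ _ → tt) (λ _ → e)

  non-edge : ∀ {x y} → ¬ x ~ y → x ~ y ⇔ T false
  non-edge ¬e = mk⇔ ¬e λ ()

  copy-injective : ∀ {k} {h : Fin k → Fin k → Bool} (f : Fin k → Fin n)
    → (∀ a b → f a ~ f b ⇔ T (h a b))
    → (∀ a b → a ≢ b → Twins h a b → f a ≢ f b)
    → Injective _≡_ _≡_ f
  copy-injective {h = h} f adj twins-apart {a} {b} fa≡fb with a ≟ᶠ b
  ... | yes a≡b = a≡b
  ... | no a≢b = ⊥-elim (twins-apart a b a≢b twins fa≡fb)
    where
    same-row : ∀ c → T (h a c) ⇔ T (h b c)
    same-row c = adj b c ⇔-∘ subst (λ x → T (h a c) ⇔ x ~ f c) fa≡fb (⇔-sym (adj a c))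
    twins : Twins h a b
    twins c = T-injective (same-row c)

  no-bull : BullFree G → ∀ {a b c d e} → a ~ b → a ~ c → b ~ c → d ~ a → e ~ b
    → ¬ a ~ e → ¬ b ~ d → ¬ c ~ d → ¬ c ~ e → ¬ d ~ e → ⊥
  no-bull bf {a} {b} {c} {d} {e} ab ac bc da eb ¬ae ¬bd ¬cd ¬ce ¬de =
    bf (f , copy-injective f adj (λ i j i≢j twins → ⊥-elim (i≢j (bull-twin-free i j twins))) , adj)
    where
    f : Fin 5 → Fin n
    f f0 = a
    f (fs f0) = b
    f (fs (fs f0)) = c
    f (fs (fs (fs f0))) = d
    f (fs (fs (fs (fs f0)))) = e
    adj : ∀ i j → f i ~ f j ⇔ T (bullAdj i j)
    adj f0 f0 = non-edge (irrefl G)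
    adj f0 (fs f0) = edge ab
    adj f0 (fs (fs f0)) = edge ac
    adj f0 (fs (fs (fs f0))) = edge (~-sym da)
    adj f0 (fs (fs (fs (fs f0)))) = non-edge ¬ae
    adj (fs f0) f0 = edge (~-sym ab)
    adj (fs f0) (fs f0) = non-edge (irrefl G)
    adj (fs f0) (fs (fs f0)) = edge bc
    adj (fs f0) (fs (fs (fs f0))) = non-edge ¬bd
    adj (fs f0) (fs (fs (fs (fs f0)))) = edge (~-sym eb)
    adj (fs (fs f0)) f0 = edge (~-sym ac)
    adj (fs (fs f0)) (fs f0) = edge (~-sym bc)
    adj (fs (fs f0)) (fs (fs f0)) = non-edge (irrefl G)
    adj (fs (fs f0)) (fs (fs (fs f0))) = non-edge ¬cd
    adj (fs (fs f0)) (fs (fs (fs (fs f0)))) = non-edge ¬ce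
    adj (fs (fs (fs f0))) f0 = edge da
    adj (fs (fs (fs f0))) (fs f0) = non-edge (λ db → ¬bd (~-sym db))
    adj (fs (fs (fs f0))) (fs (fs f0)) = non-edge (λ dc → ¬cd (~-sym dc))
    adj (fs (fs (fs f0))) (fs (fs (fs f0))) = non-edge (irrefl G)
    adj (fs (fs (fs f0))) (fs (fs (fs (fs f0)))) = non-edge ¬de
    adj (fs (fs (fs (fs f0)))) f0 = non-edge (λ ea → ¬ae (~-sym ea))
    adj (fs (fs (fs (fs f0)))) (fs f0) = edge eb
    adj (fs (fs (fs (fs f0)))) (fs (fs f0)) = non-edge (λ ec → ¬ce (~-sym ec))
    adj (fs (fs (fs (fs f0)))) (fs (fs (fs f0))) = non-edge (λ ed → ¬de (~-sym ed))
    adj (fs (fs (fs (fs f0)))) (fs (fs (fs (fs f0)))) = non-edge (irrefl G)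

  no-diamond : DiamondFree G → ∀ {a b c d} → a ~ b → a ~ c → a ~ d → b ~ c → b ~ d
    → ¬ c ~ d → c ≢ d → ⊥
  no-diamond df {a} {b} {c} {d} ab ac ad bc bd ¬cd c≢d = df (f , copy-injective f adj twins-apart , adj)
    where
    f : Fin 4 → Fin n
    f f0 = a
    f (fs f0) = b
    f (fs (fs f0)) = c
    f (fs (fs (fs f0))) = d
    adj : ∀ i j → f i ~ f j ⇔ T (diamondAdj i j)
    adj f0 f0 = non-edge (irrefl G)
    adj f0 (fs f0) = edge ab
    adj f0 (fs (fs f0)) = edge ac
    adj f0 (fs (fs (fs f0))) = edge ad
    adj (fs f0) f0 = edge (~-sym ab)
    adj (fs f0) (fs f0) = non-edge (irrefl G)
    adj (fs f0) (fs (fs f0)) = edge bc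
    adj (fs f0) (fs (fs (fs f0))) = edge bd
    adj (fs (fs f0)) f0 = edge (~-sym ac)
    adj (fs (fs f0)) (fs f0) = edge (~-sym bc)
    adj (fs (fs f0)) (fs (fs f0)) = non-edge (irrefl G)
    adj (fs (fs f0)) (fs (fs (fs f0))) = non-edge ¬cd
    adj (fs (fs (fs f0))) f0 = edge (~-sym ad)
    adj (fs (fs (fs f0))) (fs f0) = edge (~-sym bd)
    adj (fs (fs (fs f0))) (fs (fs f0)) = non-edge (λ dc → ¬cd (~-sym dc))
    adj (fs (fs (fs f0))) (fs (fs (fs f0))) = non-edge (irrefl G)
    twins-apart : ∀ i j → i ≢ j → Twins diamondAdj i j → f i ≢ f j
    twins-apart i j i≢j twins with diamond-twins i j twins
    ... | inj₁ i≡j = ⊥-elim (i≢j i≡j)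
    ... | inj₂ (inj₁ refl) = c≢d
    ... | inj₂ (inj₂ refl) = λ d≡c → c≢d (≡-sym d≡c)

  adjacent-to-third : DiamondFree G → ∀ {p q s w} → p ~ q → p ~ s → q ~ s → w ~ p → w ~ q → w ≢ s → w ~ s
  adjacent-to-third df {s = s} {w} p~q p~s q~s w~p w~q w≢s with dec G w s
  ... | yes w~s = w~s
  ... | no ¬w~s = ⊥-elim (no-diamond df p~q (~-sym w~p) p~s (~-sym w~q) q~s ¬w~s w≢s)

  pendants-adjacent : BullFree G → ∀ {p q s x y} → p ~ q → p ~ s → q ~ s
    → x ~ p → ¬ x ~ q → ¬ x ~ s → y ~ q → ¬ y ~ p → ¬ y ~ s → x ~ y
  pendants-adjacent bf {x = x} {y} p~q p~s q~s x~p ¬x~q ¬x~s y~q ¬y~p ¬y~s with dec G x y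
  ... | yes x~y = x~y
  ... | no ¬x~y = ⊥-elim (no-bull bf p~q p~s q~s x~p y~q (¬y~p ∘ ~-sym) (¬x~q ∘ ~-sym)
                            (¬x~s ∘ ~-sym) (¬y~s ∘ ~-sym) ¬x~y)

  reach-source : ∀ {S p q} → ReachIn G S p q → S p
  reach-source (base Sp) = Sp
  reach-source (step Sp _ _) = Sp

  reach-target : ∀ {S p q} → ReachIn G S p q → S q
  reach-target (base Sq) = Sq
  reach-target (step _ _ r) = reach-target r

  reach-snoc : ∀ {S p q r} → ReachIn G S p q → q ~ r → S r → ReachIn G S p r
  reach-snoc (base Sq) q~r Sr = step Sq q~r (base Sr)
  reach-snoc (step Sp p~p′ p′→q) q~r Sr = step Sp p~p′ (reach-snoc p′→q q~r Sr)

  component-⊆ : ∀ {S C x} → IsComponent G S C → C x → S x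
  component-⊆ (_ , _ , C≃reach) Cx = reach-target (Equivalence.to (C≃reach _) Cx)

  component-closed : ∀ {S C x y} → IsComponent G S C → C x → S y → x ~ y → C y
  component-closed (_ , _ , C≃reach) Cx Sy x~y =
    Equivalence.from (C≃reach _) (reach-snoc (Equivalence.to (C≃reach _) Cx) x~y Sy)

  component-invariant : ∀ {S C} (P : Fin n → Set) → IsComponent G S C
    → (∀ {a b} → S b → a ~ b → P a → P b) → ∀ {x y} → C x → C y → P x → P y
  component-invariant {S} P (_ , _ , C≃reach) preserved Cx Cy =
    proj₁ (along (Equivalence.to (C≃reach _) Cy)) ∘ proj₂ (along (Equivalence.to (C≃reach _) Cx))
    where
    along : ∀ {p q} → ReachIn G S p q → (P p → P q) × (P q → P p)
    along (base _) = (λ Pp → Pp) , (λ Pq → Pq)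
    along (step Sp p~r r→q) =
      let forward , backward = along r→q
      in forward ∘ preserved (reach-source r→q) p~r , preserved Sp (~-sym p~r) ∘ backward

  component-root : ∀ {S C} (comp : IsComponent G S C) → C (proj₁ comp)
  component-root (x₀ , Sx₀ , C≃reach) = Equivalence.from (C≃reach x₀) (base Sx₀)

  other-in : ∀ {C} → HasTriangle G C → ∀ x y → ∃ λ a → C a × a ≢ x × a ≢ y
  other-in (_ , _ , _ , Cp , Cq , Cs , p~q , q~s , p~s) =
    avoid-two _≟ᶠ_ _ Cp Cq Cs (~⇒≢ p~q) (~⇒≢ p~s) (~⇒≢ q~s)

  two-others : ∀ {C} → HasTriangle G C → ∀ x → ∃ λ a → ∃ λ b → C a × C b × a ≢ x × b ≢ x × b ≢ a
  two-others tri x with other-in tri x x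
  ... | a , Ca , a≢x , _ with other-in tri x a
  ... | b , Cb , b≢x , b≢a = a , b , Ca , Cb , a≢x , b≢x , b≢a

  P₃FreeOn : (Fin n → Set) → Set
  P₃FreeOn S = ∀ {x y z} → S x → S y → S z → x ~ y → y ~ z → x ≢ z → x ~ z

  P₃-free⇒disjoint-cliques : ∀ {S} → P₃FreeOn S → DisjointUnionOfCliques G S
  P₃-free⇒disjoint-cliques {S} closed C (x₀ , _ , C≃reach) x y Cx Cy x≢y =
    join (equal-or-adjacent x₀→x) (equal-or-adjacent x₀→y)
    where
    x₀→x : ReachIn G S x₀ x
    x₀→x = Equivalence.to (C≃reach x) Cx
    x₀→y : ReachIn G S x₀ y
    x₀→y = Equivalence.to (C≃reach y) Cy
    equal-or-adjacent : ∀ {p q} → ReachIn G S p q → p ≡ q ⊎ p ~ q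
    equal-or-adjacent (base _) = inj₁ refl
    equal-or-adjacent {p} {q} (step Sp p~r r→q) with equal-or-adjacent r→q | p ≟ᶠ q
    ... | inj₁ refl | _ = inj₂ p~r
    ... | inj₂ _ | yes p≡q = inj₁ p≡q
    ... | inj₂ r~q | no p≢q = inj₂ (closed Sp (reach-source r→q) (reach-target r→q) p~r r~q p≢q)
    join : x₀ ≡ x ⊎ x₀ ~ x → x₀ ≡ y ⊎ x₀ ~ y → x ~ y
    join (inj₁ refl) (inj₁ refl) = ⊥-elim (x≢y refl)
    join (inj₁ refl) (inj₂ x~y) = x~y
    join (inj₂ x₀~x) (inj₁ refl) = ~-sym x₀~x
    join (inj₂ x₀~x) (inj₂ x₀~y) =
      closed (reach-target x₀→x) (reach-source x₀→x) (reach-target x₀→y) (~-sym x₀~x) x₀~y x≢y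

  cons-clique : ∀ {m x} {g : Fin m → Fin n} → IsClique G g → (∀ b → x ~ g b) → IsClique G (x ◂ g)
  cons-clique {x = x} {g} (g-inj , g-adj) x~g = inj , adj
    where
    inj : Injective _≡_ _≡_ (x ◂ g)
    inj {f0} {f0} _ = refl
    inj {f0} {fs b} x≡gb = ⊥-elim (~⇒≢ (x~g b) x≡gb)
    inj {fs b} {f0} gb≡x = ⊥-elim (~⇒≢ (x~g b) (≡-sym gb≡x))
    inj {fs b} {fs b′} gb≡gb′ = cong fs (g-inj gb≡gb′)
    adj : ∀ i j → i ≢ j → (x ◂ g) i ~ (x ◂ g) j
    adj f0 f0 i≢j = ⊥-elim (i≢j refl)
    adj f0 (fs b) _ = x~g b
    adj (fs b) f0 _ = ~-sym (x~g b)
    adj (fs b) (fs b′) i≢j = g-adj b b′ (λ b≡b′ → i≢j (cong fs b≡b′))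

  ProperOn : ∀ {k} → (Fin n → Set) → (Fin n → Fin k) → Set
  ProperOn S c = ∀ x y → S x → S y → x ~ y → c x ≢ c y

  proper-mono : ∀ {k} {S T : Fin n → Set} {c : Fin n → Fin k}
    → (∀ y → T y → S y) → ProperOn S c → ProperOn T c
  proper-mono T⊆S c-proper x y Tx Ty = c-proper x y (T⊆S x Tx) (T⊆S y Ty)

  clique-size≤colours : ∀ {m k} {S : Fin n → Set} {c : Fin n → Fin k} {u : Fin m → Fin n}
    → IsClique G u → (∀ a → S (u a)) → ProperOn S c → m ≤ k
  clique-size≤colours {c = c} {u} (_ , u-adj) S∋u c-proper = ≮⇒≥ λ k<m →
    let a , b , a<b , same = pigeonhole k<m (c ∘ u)
    in c-proper (u a) (u b) (S∋u a) (S∋u b) (u-adj a b (<⇒≢ a<b)) same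

  NeighbourhoodCliqueIn : (Fin n → Set) → Fin n → Set
  NeighbourhoodCliqueIn S x = ∀ y z → S y → S z → x ~ y → x ~ z → y ≢ z → y ~ z

  _[_≔_] : ∀ {k} → (Fin n → Fin k) → Fin n → Fin k → Fin n → Fin k
  (c [ x ≔ α ]) y with y ≟ᶠ x
  ... | yes _ = α
  ... | no _ = c y

  update-at : ∀ {k} (c : Fin n → Fin k) x α → (c [ x ≔ α ]) x ≡ α
  update-at c x α with x ≟ᶠ x
  ... | yes _ = refl
  ... | no x≢x = ⊥-elim (x≢x refl)

  update-elsewhere : ∀ {k} (c : Fin n → Fin k) {x y} α → y ≢ x → (c [ x ≔ α ]) y ≡ c y
  update-elsewhere c {x} {y} α y≢x with y ≟ᶠ x
  ... | yes y≡x = ⊥-elim (y≢x y≡x)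
  ... | no _ = refl

  Extends : ∀ {k} → (Fin n → Set) → (Fin n → Fin k) → (Fin n → Fin k) → Set
  Extends S c c′ = ∀ y → S y → c′ y ≡ c y

  colour-vertex : ∀ {k} {S : Fin n → Set} {c : Fin n → Fin k} {x} (α : Fin k)
    → ProperOn S c → ¬ S x → (∀ y → S y → x ~ y → c y ≢ α)
    → ProperOn (λ y → S y ⊎ y ≡ x) (c [ x ≔ α ]) × Extends S c (c [ x ≔ α ])
  colour-vertex {S = S} {c} {x} α c-proper ¬Sx α-free = proper , extends
    where
    extends : Extends S c (c [ x ≔ α ])
    extends y Sy = update-elsewhere c α λ { refl → ¬Sx Sy }
    proper : ProperOn (λ y → S y ⊎ y ≡ x) (c [ x ≔ α ])
    proper y z (inj₁ Sy) (inj₁ Sz) y~z rewrite extends y Sy | extends z Sz = c-proper y z Sy Sz y~z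
    proper y z (inj₁ Sy) (inj₂ refl) y~z rewrite extends y Sy | update-at c x α = α-free y Sy (~-sym y~z)
    proper y z (inj₂ refl) (inj₁ Sz) y~z rewrite extends z Sz | update-at c x α = α-free z Sz y~z ∘ ≡-sym
    proper y z (inj₂ refl) (inj₂ refl) y~z = ⊥-elim (irrefl G y~z)

  module _ {ω : ℕ} (no-larger-clique : ∀ (u : Fin (suc ω) → Fin n) → ¬ IsClique G u) where

    free-colour : ∀ {k} {S : Fin n → Set} (c : Fin n → Fin k) {x} → ω ≤ k → (∀ y → Dec (S y))
      → NeighbourhoodCliqueIn S x → ∃ λ α → ∀ y → S y → x ~ y → c y ≢ α
    free-colour {S = S} c {x} ω≤k S? clique-nbhd
      with any? (λ α → all? λ y → S? y →-dec dec G x y →-dec ¬? (c y ≟ᶠ α))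
    ... | yes free = free
    ... | no none = ⊥-elim (no-larger-clique (x ◂ g) (cons-clique (g-inj , g-adj) x~g))
      where
      used : ∀ b → ∃ λ y → (S y × x ~ y) × c y ≡ inject≤ b ω≤k
      used b with any? (λ y → (S? y ×-dec dec G x y) ×-dec (c y ≟ᶠ inject≤ b ω≤k))
      ... | yes witness = witness
      ... | no unused = ⊥-elim (none (inject≤ b ω≤k , λ y Sy x~y same → unused (y , (Sy , x~y) , same)))
      g : Fin ω → Fin n
      g b = proj₁ (used b)
      S∋g : ∀ b → S (g b)
      S∋g b = proj₁ (proj₁ (proj₂ (used b)))
      x~g : ∀ b → x ~ g b
      x~g b = proj₂ (proj₁ (proj₂ (used b)))
      c∘g : ∀ b → c (g b) ≡ inject≤ b ω≤k
      c∘g b = proj₂ (proj₂ (used b))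
      g-inj : Injective _≡_ _≡_ g
      g-inj {b} {b′} gb≡gb′ =
        inject≤-injective ω≤k ω≤k b b′ (trans (≡-sym (c∘g b)) (trans (cong c gb≡gb′) (c∘g b′)))
      g-adj : ∀ b b′ → b ≢ b′ → g b ~ g b′
      g-adj b b′ b≢b′ = clique-nbhd (g b) (g b′) (S∋g b) (S∋g b′) (x~g b) (x~g b′) (b≢b′ ∘ g-inj)

    greedy-extend : ∀ {k} {S A : Fin n → Set} {c : Fin n → Fin k} → ω ≤ k
      → (∀ y → Dec (S y)) → (∀ y → Dec (A y)) → ProperOn S c
      → (∀ x → A x → NeighbourhoodCliqueIn (λ y → S y ⊎ A y) x)
      → Σ (Fin n → Fin k) λ c′ → ProperOn (λ y → S y ⊎ A y) c′ × Extends S c c′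
    greedy-extend {k} {S} {A} {c} ω≤k S? A? c-proper clique-nbhd with along (allFin n)
      where
      Upto : List (Fin n) → Fin n → Set
      Upto xs y = S y ⊎ (A y × y ∈ xs)
      unfold : ∀ {x xs y} → Upto (x ∷ xs) y → Upto xs y ⊎ (A y × y ≡ x)
      unfold (inj₁ Sy) = inj₁ (inj₁ Sy)
      unfold (inj₂ (Ay , here y≡x)) = inj₂ (Ay , y≡x)
      unfold (inj₂ (Ay , there y∈xs)) = inj₁ (inj₂ (Ay , y∈xs))
      skip : ∀ {x xs} → (A x → Upto xs x) → ∀ y → Upto (x ∷ xs) y → Upto xs y
      skip old y U with unfold U
      ... | inj₁ U′ = U′
      ... | inj₂ (Ay , refl) = old Ay
      forget : ∀ {xs y} → Upto xs y → S y ⊎ A y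
      forget (inj₁ Sy) = inj₁ Sy
      forget (inj₂ (Ay , _)) = inj₂ Ay
      along : ∀ xs → Σ (Fin n → Fin k) λ c′ → ProperOn (Upto xs) c′ × Extends S c c′
      along [] = c , proper-mono (λ { y (inj₁ Sy) → Sy ; y (inj₂ (_ , ())) }) c-proper , λ _ _ → refl
      along (x ∷ xs) with A? x | S? x ⊎-dec (A? x ×-dec (x ∈? xs))
      ... | no ¬Ax | _ =
        let c′ , proper , extends = along xs in c′ , proper-mono (skip (⊥-elim ∘ ¬Ax)) proper , extends
      ... | yes _ | yes done =
        let c′ , proper , extends = along xs in c′ , proper-mono (skip λ _ → done) proper , extends
      ... | yes Ax | no fresh =
        let c′ , proper , extends = along xs
            α , α-free = free-colour c′ ω≤k (λ y → S? y ⊎-dec (A? y ×-dec (y ∈? xs)))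
                           (λ y z Uy Uz → clique-nbhd x Ax y z (forget Uy) (forget Uz))
            proper′ , extends′ = colour-vertex α proper fresh α-free
        in c′ [ x ≔ α ] , proper-mono (λ y U → unfold′ (unfold U)) proper′
           , λ y Sy → trans (extends′ y (inj₁ Sy)) (extends y Sy)
        where
        unfold′ : ∀ {y} → Upto xs y ⊎ (A y × y ≡ x) → Upto xs y ⊎ y ≡ x
        unfold′ (inj₁ U) = inj₁ U
        unfold′ (inj₂ (_ , y≡x)) = inj₂ y≡x
    ... | c′ , proper , extends = c′ , proper-mono everything proper , extends
      where
      everything : ∀ y → S y ⊎ A y → S y ⊎ (A y × y ∈ allFin n)
      everything y (inj₁ Sy) = inj₁ Sy
      everything y (inj₂ Ay) = inj₂ (Ay , ∈-allFin y)

  module _ {ω : ℕ} (v : Fin ω → Fin n) where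

    N : ℕ → Fin n → Set
    N = Nb G v

    Reaches : ℕ → Fin n → Set
    Reaches m x = ∃ λ a → Walk G x (v a) m

    ReachesBefore : ℕ → Fin n → Set
    ReachesBefore m x = ∃ λ m′ → m′ < m × Reaches m′ x

    Below : ℕ → Fin n → Set
    Below i x = ∃ λ m → m < i × N m x

    walk-zero : ∀ {x y} → Walk G x y 0 → x ≡ y
    walk-zero (here _) = refl

    reaches? : ∀ m x → Dec (Reaches m x)
    reaches? zero x = map′ (λ (a , x≡va) → a , subst (λ y → Walk G x y 0) x≡va (here x))
                           (λ (a , w) → a , walk-zero w) (any? λ a → x ≟ᶠ v a)
    reaches? (suc m) x = map′ (λ (y , x~y , a , w) → a , step x~y w) (λ { (a , step x~y w) → _ , x~y , a , w })
                              (any? λ y → dec G x y ×-dec reaches? m y)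

    reaches-before? : ∀ m x → Dec (ReachesBefore m x)
    reaches-before? zero x = no λ ()
    reaches-before? (suc m) x with reaches? m x | reaches-before? m x
    ... | yes r | _ = yes (m , ≤-refl , r)
    ... | no _ | yes (m′ , m′<m , r) = yes (m′ , m≤n⇒m≤1+n m′<m , r)
    ... | no ¬r | no ¬before = no λ (m′ , m′<1+m , r) → earlier m′ (≤-pred m′<1+m) r
      where
      earlier : ∀ m′ → m′ ≤ m → ¬ Reaches m′ x
      earlier m′ m′≤m r with m′ ℕ.≟ m
      ... | yes refl = ¬r r
      ... | no m′≢m = ¬before (m′ , ≤∧≢⇒< m′≤m m′≢m , r)

    N-minimal : ∀ {j m x} → N j x → Reaches m x → j ≤ m
    N-minimal (_ , shortest) (a , w) = ≮⇒≥ λ m<j → shortest _ m<j a w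

    level-of : ∀ {m x} → Reaches m x → ∃ λ j → N j x
    level-of {m} {x} = <-rec (λ m → Reaches m x → ∃ λ j → N j x) least m
      where
      least : ∀ m → (∀ {m′} → m′ < m → Reaches m′ x → ∃ λ j → N j x) → Reaches m x → ∃ λ j → N j x
      least m shorter r with reaches-before? m x
      ... | yes (m′ , m′<m , r′) = shorter m′<m r′
      ... | no ¬before = m , r , λ m′ m′<m a w → ¬before (m′ , m′<m , a , w)

    N-unique : ∀ {a b x} → N a x → N b x → a ≡ b
    N-unique {a} {b} Nax Nbx with <-cmp a b
    ... | tri< a<b _ _ = ⊥-elim (proj₂ Nbx a a<b (proj₁ (proj₁ Nax)) (proj₂ (proj₁ Nax)))
    ... | tri≈ _ a≡b _ = a≡b
    ... | tri> _ _ b<a = ⊥-elim (proj₂ Nax b b<a (proj₁ (proj₁ Nbx)) (proj₂ (proj₁ Nbx)))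

    N-distinct : ∀ {a b x y} → N a x → N b y → a ≢ b → x ≢ y
    N-distinct Nax Nby a≢b refl = a≢b (N-unique Nax Nby)

    N-nonadjacent : ∀ {a b x y} → N a x → N b y → suc a < b → ¬ x ~ y
    N-nonadjacent ((c , w) , _) (_ , shortest) 1+a<b x~y = shortest _ 1+a<b c (step (~-sym x~y) w)

    N-gap : ∀ {a x y} → N a x → N (2 + a) y → ¬ x ~ y
    N-gap Nx Ny = N-nonadjacent Nx Ny ≤-refl

    N-step-distinct : ∀ {a x y} → N a x → N (1 + a) y → x ≢ y
    N-step-distinct Nx Ny = N-distinct Nx Ny (<⇒≢ℕ ≤-refl)

    N-predecessor : ∀ {a x} → N (suc a) x → ∃ λ y → x ~ y × N a y
    N-predecessor {a} ((c , step {y = y} x~y w) , shortest) with level-of (c , w)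
    ... | b , Nby = y , x~y , subst (λ b → N b y) (≤-antisym b≤a a≤b) Nby
      where
      b≤a : b ≤ a
      b≤a = N-minimal Nby (c , w)
      a≤b : a ≤ b
      a≤b = ≤-pred (≮⇒≥ λ 1+b<1+a → N-nonadjacent Nby ((c , step x~y w) , shortest) 1+b<1+a (~-sym x~y))

    N-zero⇒InK : ∀ {x} → N 0 x → InK G v x
    N-zero⇒InK ((a , w) , _) = a , ≡-sym (walk-zero w)

    InK⇒N-zero : ∀ {x} → InK G v x → N 0 x
    InK⇒N-zero (a , refl) = (a , here (v a)) , λ _ ()

    N? : ∀ m x → Dec (N m x)
    N? m x = reaches? m x ×-dec map′ (λ none m′ m′<m a w → none (m′ , m′<m , a , w))
                                      (λ shortest (m′ , m′<m , a , w) → shortest m′ m′<m a w)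
                                      (¬? (reaches-before? m x))

    N⇒¬Below : ∀ {i x} → N i x → ¬ Below i x
    N⇒¬Below Nix (m , m<i , Nmx) with N-unique Nix Nmx
    ... | refl = <⇒≢ℕ m<i refl

    N-ancestor : ∀ k {j x} → N (k + j) x → ∃ (N j)
    N-ancestor zero Nx = _ , Nx
    N-ancestor (suc k) Nx = N-ancestor k (proj₂ (proj₂ (N-predecessor Nx)))

    Below? : ∀ i x → Dec (Below i x)
    Below? i x = map′ (λ (m , m<i , r) → let j , Njx = level-of r in j , ≤-trans (s≤s (N-minimal Njx r)) m<i , Njx)
                      (λ (m , m<i , Nmx) → m , m<i , proj₁ Nmx) (reaches-before? i x)

    module Structure (bf : BullFree G) (df : DiamondFree G) (mc : IsMaxClique G v) (2<ω : 2 < ω) where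

      v-adjacent : ∀ a b → a ≢ b → v a ~ v b
      v-adjacent = proj₂ (proj₁ mc)

      InK? : ∀ x → Dec (InK G v x)
      InK? x = any? λ a → v a ≟ᶠ x

      one-neighbour-in-K : ∀ {x a b} → ¬ InK G v x → x ~ v a → x ~ v b → a ≡ b
      one-neighbour-in-K {x} {a} {b} x∉K x~va x~vb with a ≟ᶠ b
      ... | yes a≡b = a≡b
      ... | no a≢b with any? (λ c → ¬? (dec G x (v c)))
      ... | yes (c , ¬x~vc) = ⊥-elim (no-diamond df (v-adjacent a b a≢b) (~-sym x~va)
                                 (v-adjacent a c λ { refl → ¬x~vc x~va }) (~-sym x~vb)
                                 (v-adjacent b c λ { refl → ¬x~vc x~vb }) ¬x~vc (λ x≡vc → x∉K (c , ≡-sym x≡vc)))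
      ... | no sees-all = ⊥-elim (proj₂ mc (x ◂ v) (cons-clique (proj₁ mc) x~v))
        where
        x~v : ∀ c → x ~ v c
        x~v c with dec G x (v c)
        ... | yes x~vc = x~vc
        ... | no ¬x~vc = ⊥-elim (sees-all (c , ¬x~vc))

      K-needs-colours : ∀ {i k} {c : Fin n → Fin k} → ProperOn (Below (suc i)) c → ω ≤ k
      K-needs-colours = clique-size≤colours (proj₁ mc) λ a → 0 , s≤s z≤n , InK⇒N-zero (a , refl)

      K-neighbour⇒W : ∀ {a y} → ¬ InK G v y → y ~ v a → W G v a y
      K-neighbour⇒W y∉K y~va = y∉K , y~va , λ b y~vb → one-neighbour-in-K y∉K y~vb y~va

      W? : ∀ a x → Dec (W G v a x)
      W? a x = ¬? (InK? x) ×-dec dec G x (v a) ×-dec all? λ b → dec G x (v b) →-dec (b ≟ᶠ a)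

      W-unique : ∀ {a b x} → W G v a x → W G v b x → a ≡ b
      W-unique (_ , x~va , _) (_ , _ , only-b) = only-b _ x~va

      W-nonadjacent : ∀ {a b x} → W G v a x → a ≢ b → ¬ x ~ v b
      W-nonadjacent (_ , _ , only-a) a≢b x~vb = a≢b (≡-sym (only-a _ x~vb))

      W∉K : ∀ {a b x} → W G v a x → x ≢ v b
      W∉K (x∉K , _) x≡vb = x∉K (_ , ≡-sym x≡vb)

      N-one⇒W : ∀ {x} → N 1 x → ∃ λ a → W G v a x
      N-one⇒W {x} N1x@((a , step x~va w) , _) with walk-zero w
      ... | refl = a , K-neighbour⇒W x∉K x~va
        where
        x∉K : ¬ InK G v x
        x∉K x∈K with N-unique N1x (InK⇒N-zero x∈K)
        ... | ()

      W⇒N-one : ∀ {a x} → W G v a x → N 1 x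
      W⇒N-one {a} {x} (x∉K , x~va , _) =
        (a , step x~va (here (v a))) , λ { zero _ c w → x∉K (c , ≡-sym (walk-zero w)) ; (suc _) (s≤s ()) }

      W-adjacent : ∀ {a b x y} → W G v a x → W G v b y → a ≢ b → x ~ y
      W-adjacent {a} {b} {x} {y} (_ , x~va , only-a) (_ , y~vb , only-b) a≢b with dec G x y
      ... | yes x~y = x~y
      ... | no ¬x~y with other-index 2<ω a b
      ... | c , c≢a , c≢b = ⊥-elim (no-bull bf (v-adjacent a b a≢b) (v-adjacent a c (c≢a ∘ ≡-sym))
            (v-adjacent b c (c≢b ∘ ≡-sym)) x~va y~vb (λ va~y → a≢b (only-b a (~-sym va~y)))
            (λ vb~x → a≢b (≡-sym (only-a b (~-sym vb~x)))) (λ vc~x → c≢a (only-a c (~-sym vc~x)))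
            (λ vc~y → c≢b (only-b c (~-sym vc~y))) ¬x~y)

      Occupied : Fin ω → Set
      Occupied a = ∃ (W G v a)

      Occupied? : ∀ a → Dec (Occupied a)
      Occupied? a = any? (W? a)

      ThreeOccupied : Set
      ThreeOccupied = ∃ λ a₁ → ∃ λ a₂ → ∃ λ a₃ →
        (a₁ ≢ a₂ × a₁ ≢ a₃ × a₂ ≢ a₃) × (Occupied a₁ × Occupied a₂ × Occupied a₃)

      ThreeOccupied? : Dec ThreeOccupied
      ThreeOccupied? = any? λ a₁ → any? λ a₂ → any? λ a₃ →
        (¬? (a₁ ≟ᶠ a₂) ×-dec ¬? (a₁ ≟ᶠ a₃) ×-dec ¬? (a₂ ≟ᶠ a₃))
        ×-dec (Occupied? a₁ ×-dec Occupied? a₂ ×-dec Occupied? a₃)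

      module ThreeClasses (conn : Connected G)
               {a₁ a₂ a₃ : Fin ω} (a₁≢a₂ : a₁ ≢ a₂) (a₁≢a₃ : a₁ ≢ a₃) (a₂≢a₃ : a₂ ≢ a₃)
               {x₁ x₂ x₃ : Fin n} (W₁ : W G v a₁ x₁) (W₂ : W G v a₂ x₂) (W₃ : W G v a₃ x₃) where

        occupied-avoiding : ∀ a b → ∃ λ c → Occupied c × c ≢ a × c ≢ b
        occupied-avoiding = avoid-two _≟ᶠ_ Occupied (x₁ , W₁) (x₂ , W₂) (x₃ , W₃) a₁≢a₂ a₁≢a₃ a₂≢a₃

        W-singleton : ∀ {a x x′} → W G v a x → W G v a x′ → x ≡ x′
        W-singleton {a} {x} {x′} Wx Wx′ with x ≟ᶠ x′
        ... | yes x≡x′ = x≡x′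
        ... | no x≢x′ with occupied-avoiding a a
        ... | b , (z , Wz) , b≢a , _ with occupied-avoiding a b
        ... | c , (z′ , Wz′) , c≢a , c≢b with dec G x x′
        ... | yes x~x′ = ⊥-elim (no-diamond df x~x′ (proj₁ (proj₂ Wx)) (~-sym (W-adjacent Wz Wx b≢a))
                           (proj₁ (proj₂ Wx′)) (~-sym (W-adjacent Wz Wx′ b≢a))
                           (W-nonadjacent Wz b≢a ∘ ~-sym) (W∉K Wz ∘ ≡-sym))
        ... | no ¬x~x′ = ⊥-elim (no-diamond df (W-adjacent Wz Wz′ (c≢b ∘ ≡-sym)) (W-adjacent Wz Wx b≢a)
                            (W-adjacent Wz Wx′ b≢a) (W-adjacent Wz′ Wx c≢a) (W-adjacent Wz′ Wx′ c≢a)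
                            ¬x~x′ x≢x′)

        N-one-clique : ∀ {x y} → N 1 x → N 1 y → x ≢ y → x ~ y
        N-one-clique N1x N1y x≢y with N-one⇒W N1x | N-one⇒W N1y
        ... | a , Wx | b , Wy with a ≟ᶠ b
        ... | yes refl = ⊥-elim (x≢y (W-singleton Wx Wy))
        ... | no a≢b = W-adjacent Wx Wy a≢b

        N-two-sees-N-one : ∀ {w y} → N 2 w → N 1 y → w ~ y
        N-two-sees-N-one {w} {y} N2w N1y with N-predecessor N2w
        ... | x , w~x , N1x with y ≟ᶠ x | N-one⇒W N1x | N-one⇒W N1y
        ... | yes refl | _ | _ = w~x
        ... | no y≢x | a , Wx | b , Wy with a ≟ᶠ b
        ... | yes refl = ⊥-elim (y≢x (W-singleton Wy Wx))
        ... | no a≢b with occupied-avoiding a b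
        ... | c , (z , Wz) , c≢a , c≢b with dec G w y
        ... | yes w~y = w~y
        ... | no ¬w~y with dec G w z
        ... | yes w~z = ⊥-elim (no-diamond df (W-adjacent Wx Wz (c≢a ∘ ≡-sym)) (~-sym w~x) (W-adjacent Wx Wy a≢b)
                           (~-sym w~z) (W-adjacent Wz Wy c≢b) ¬w~y (N-distinct N2w N1y λ ()))
        ... | no ¬w~z = ⊥-elim (no-bull bf (W-adjacent Wx Wy a≢b) (W-adjacent Wx Wz (c≢a ∘ ≡-sym))
                           (W-adjacent Wy Wz (c≢b ∘ ≡-sym)) w~x (~-sym (proj₁ (proj₂ Wy)))
                           (W-nonadjacent Wx a≢b) (¬w~y ∘ ~-sym) (¬w~z ∘ ~-sym) (W-nonadjacent Wz c≢b)
                           (N-nonadjacent (InK⇒N-zero (b , refl)) N2w ≤-refl ∘ ~-sym))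

        N-two-clique : ∀ {w w′} → N 2 w → N 2 w′ → w ≢ w′ → w ~ w′
        N-two-clique {w} {w′} N2w N2w′ w≢w′ with dec G w w′
        ... | yes w~w′ = w~w′
        ... | no ¬w~w′ =
          ⊥-elim (no-diamond df (W-adjacent W₁ W₂ a₁≢a₂) (sees N2w W₁) (sees N2w′ W₁) (sees N2w W₂)
                   (sees N2w′ W₂) ¬w~w′ w≢w′)
          where
          sees : ∀ {u a x} → N 2 u → W G v a x → x ~ u
          sees N2u Wx = ~-sym (N-two-sees-N-one N2u (W⇒N-one Wx))

        no-N-three : ∀ {z} → ¬ N 3 z
        no-N-three N3z with N-predecessor N3z
        ... | w , z~w , N2w with N-predecessor N2w
        ... | x , w~x , N1x with N-one⇒W N1x
        ... | a , Wx with occupied-avoiding a a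
        ... | b , (y , Wy) , b≢a , _ =
          no-bull bf w~x (N-two-sees-N-one N2w (W⇒N-one Wy)) (W-adjacent Wx Wy (b≢a ∘ ≡-sym)) z~w
            (~-sym (proj₁ (proj₂ Wx))) (N-nonadjacent K∋va N2w ≤-refl ∘ ~-sym) (N-nonadjacent N1x N3z ≤-refl)
            (N-nonadjacent (W⇒N-one Wy) N3z ≤-refl) (W-nonadjacent Wy b≢a)
            (N-nonadjacent K∋va N3z (s≤s (s≤s z≤n)) ∘ ~-sym)
          where
          K∋va : N 0 (v a)
          K∋va = InK⇒N-zero (a , refl)

        level≤2 : ∀ x → N 0 x ⊎ N 1 x ⊎ N 2 x
        level≤2 x with level-of (a₁ , proj₂ (conn x (v a₁)))
        ... | zero , N0x = inj₁ N0x
        ... | suc zero , N1x = inj₂ (inj₁ N1x)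
        ... | suc (suc zero) , N2x = inj₂ (inj₂ N2x)
        ... | suc (suc (suc m)) , Nx = ⊥-elim (no-N-three (proj₂ (N-ancestor m (subst (λ k → N k x) (+-comm 3 m) Nx))))

        N-one-two-clique : ∀ {y z} → N 1 y ⊎ N 2 y → N 1 z ⊎ N 2 z → y ≢ z → y ~ z
        N-one-two-clique (inj₁ N1y) (inj₁ N1z) y≢z = N-one-clique N1y N1z y≢z
        N-one-two-clique (inj₁ N1y) (inj₂ N2z) _ = ~-sym (N-two-sees-N-one N2z N1y)
        N-one-two-clique (inj₂ N2y) (inj₁ N1z) _ = N-two-sees-N-one N2y N1z
        N-one-two-clique (inj₂ N2y) (inj₂ N2z) y≢z = N-two-clique N2y N2z y≢z

        class-index : Fin n → Fin ω
        class-index x with any? (λ a → W? a x)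
        ... | yes (a , _) = a
        ... | no _ = a₁

        class-index-W : ∀ {a x} → W G v a x → class-index x ≡ a
        class-index-W {a} {x} Wx with any? (λ a → W? a x)
        ... | yes (b , Wbx) = W-unique Wbx Wx
        ... | no none = ⊥-elim (none (a , Wx))

        class-index-proper : ProperOn (N 1) class-index
        class-index-proper x y N1x N1y x~y same with N-one⇒W N1x | N-one⇒W N1y
        ... | a , Wx | b , Wy = ~⇒≢ x~y (W-singleton Wx (subst (λ c → W G v c y) b≡a Wy))
          where
          b≡a : b ≡ a
          b≡a = trans (≡-sym (class-index-W Wy)) (trans (≡-sym same) (class-index-W Wx))

        colouring : Σ (Fin n → Fin ω) λ c → ProperOn (λ y → N 1 y ⊎ N 2 y) c × Extends (N 1) class-index c
        colouring = greedy-extend (proj₂ mc) ≤-refl (N? 1) (N? 2) class-index-proper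
                      λ _ _ y z N12y N12z _ _ → N-one-two-clique N12y N12z

        colour : Fin n → Fin ω
        colour = proj₁ colouring

        colour-W : ∀ {a x} → W G v a x → colour x ≡ a
        colour-W Wx = trans (proj₂ (proj₂ colouring) _ (W⇒N-one Wx)) (class-index-W Wx)

        outside-K : ∀ {y} → ¬ InK G v y → N 1 y ⊎ N 2 y
        outside-K {y} y∉K with level≤2 y
        ... | inj₁ N0y = ⊥-elim (y∉K (N-zero⇒InK N0y))
        ... | inj₂ N12y = N12y

        embedding : Fin n → Fin ω × Fin 2
        embedding y with InK? y
        ... | yes (a , _) = a , f0
        ... | no _ = colour y , fs f0

        embedding-injective : Injective _≡_ _≡_ embedding
        embedding-injective {y} {z} same with InK? y | InK? z
        ... | yes (a , refl) | yes (b , refl) = cong v (cong proj₁ same)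
        ... | yes _ | no _ = ⊥-elim (0≢1+n (cong proj₂ same))
        ... | no _ | yes _ = ⊥-elim (0≢1+n (≡-sym (cong proj₂ same)))
        ... | no y∉K | no z∉K with y ≟ᶠ z
        ... | yes y≡z = y≡z
        ... | no y≢z = ⊥-elim (proj₁ (proj₂ colouring) y z (outside-K y∉K) (outside-K z∉K)
                                 (N-one-two-clique (outside-K y∉K) (outside-K z∉K) y≢z) (cong proj₁ same))

        embedding-adjacent : ∀ y z → y ~ z → E (Kc ω □ Kc 2) (embedding y) (embedding z)
        embedding-adjacent y z y~z with InK? y | InK? z
        ... | yes (a , refl) | yes (b , refl) = inj₂ (refl , λ { refl → ~⇒≢ y~z refl })
        ... | yes (a , refl) | no z∉K = inj₁ (≡-sym (colour-W (K-neighbour⇒W z∉K (~-sym y~z))) , λ ())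
        ... | no y∉K | yes (b , refl) = inj₁ (colour-W (K-neighbour⇒W y∉K y~z) , λ ())
        ... | no y∉K | no z∉K = inj₂ (refl , proj₁ (proj₂ colouring) y z (outside-K y∉K) (outside-K z∉K) y~z)

      three-occupied⇒embeds : Connected G → ThreeOccupied → IsoToSubgraphOf G (Kc ω □ Kc 2)
      three-occupied⇒embeds conn (_ , _ , _ , (a₁≢a₂ , a₁≢a₃ , a₂≢a₃) , ((_ , W₁) , (_ , W₂) , (_ , W₃))) =
        embedding , embedding-injective , embedding-adjacent
        where open ThreeClasses conn a₁≢a₂ a₁≢a₃ a₂≢a₃ W₁ W₂ W₃

      W-P₃-free : ∀ a → P₃FreeOn (W G v a)
      W-P₃-free a (_ , x~va , _) (_ , y~va , _) (_ , z~va , _) x~y y~z x≢z =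
        ~-sym (adjacent-to-third df (~-sym y~va) (~-sym x~va) (~-sym x~y) z~va (~-sym y~z) (x≢z ∘ ≡-sym))

      one-class⇒cliques : ∀ {a} → SetEq (N 1) (W G v a) → DisjointUnionOfCliques G (N 1)
      one-class⇒cliques N1≃W = P₃-free⇒disjoint-cliques λ N1x N1y N1z →
        W-P₃-free _ (into N1x) (into N1y) (into N1z)
        where
        into : ∀ {x} → N 1 x → W G v _ x
        into {x} = Equivalence.to (N1≃W x)

      W-independent : ∀ {a b x y z} → W G v a x → W G v a y → W G v b z → b ≢ a → ¬ x ~ y
      W-independent Wx Wy Wz b≢a x~y = no-diamond df x~y (proj₁ (proj₂ Wx)) (~-sym (W-adjacent Wz Wx b≢a))
        (proj₁ (proj₂ Wy)) (~-sym (W-adjacent Wz Wy b≢a)) (W-nonadjacent Wz b≢a ∘ ~-sym) (W∉K Wz ∘ ≡-sym)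

      ClassesCover : Fin ω → Fin ω → Set
      ClassesCover i j = ∀ c → Occupied c → c ≡ i ⊎ c ≡ j

      two-classes-cover : ¬ ThreeOccupied → ∃ λ i → ∃ λ j → ClassesCover i j
      two-classes-cover ¬three with any? Occupied?
      ... | no none = fromℕ< 2<ω , fromℕ< 2<ω , λ c occ → ⊥-elim (none (c , occ))
      ... | yes (a , occ-a) with any? (λ b → ¬? (b ≟ᶠ a) ×-dec Occupied? b)
      ... | no only-a = a , a , λ c occ → inj₁ (decidable-stable (c ≟ᶠ a) λ c≢a → only-a (c , c≢a , occ))
      ... | yes (b , b≢a , occ-b) = a , b , cover
        where
        cover : ClassesCover a b
        cover c occ-c with c ≟ᶠ a | c ≟ᶠ b
        ... | yes c≡a | _ = inj₁ c≡a
        ... | no _ | yes c≡b = inj₂ c≡b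
        ... | no c≢a | no c≢b =
          ⊥-elim (¬three (a , b , c , (b≢a ∘ ≡-sym , c≢a ∘ ≡-sym , c≢b ∘ ≡-sym) , occ-a , occ-b , occ-c))

      module _ {i j : Fin ω} (cover : ClassesCover i j) where

        N-one≃W-union : SetEq (N 1) (λ x → W G v i x ⊎ W G v j x)
        N-one≃W-union x = mk⇔ (λ N1x → let a , Wx = N-one⇒W N1x in in-cover (cover a (x , Wx)) Wx)
                              (λ { (inj₁ Wx) → W⇒N-one Wx ; (inj₂ Wx) → W⇒N-one Wx })
          where
          in-cover : ∀ {a} → a ≡ i ⊎ a ≡ j → W G v a x → W G v i x ⊎ W G v j x
          in-cover (inj₁ refl) Wx = inj₁ Wx
          in-cover (inj₂ refl) Wx = inj₂ Wx

        W-union-member : ∀ {x} → N 1 x → W G v i x ⊎ W G v j x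
        W-union-member {x} = Equivalence.to (N-one≃W-union x)

        drop-empty : ∀ {a b} → ¬ Occupied b → (∀ {x} → N 1 x → W G v a x ⊎ W G v b x) → SetEq (N 1) (W G v a)
        drop-empty ¬occ-b member x =
          mk⇔ (λ N1x → [ (λ Wa → Wa) , (λ Wb → ⊥-elim (¬occ-b (x , Wb))) ]′ (member N1x)) W⇒N-one

        two-classes⇒bipartite : ¬ (SetEq (N 1) (W G v i) ⊎ SetEq (N 1) (W G v j))
          → CompleteBipartite G (N 1) (W G v i) (W G v j)
        two-classes⇒bipartite ¬one = N-one≃W-union , (λ x (Wi , Wj) → i≢j (W-unique Wi Wj)) , adjacency
          where
          occupied-i : Occupied i
          occupied-i = decidable-stable (Occupied? i) λ ¬occ → ¬one (inj₂ (drop-empty ¬occ (swap ∘ W-union-member)))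
          occupied-j : Occupied j
          occupied-j = decidable-stable (Occupied? j) λ ¬occ → ¬one (inj₁ (drop-empty ¬occ W-union-member))
          i≢j : i ≢ j
          i≢j refl = ¬one (inj₁ λ x → mk⇔ (λ N1x → reduce (W-union-member N1x)) W⇒N-one)
          adjacency : ∀ x y → N 1 x → N 1 y → x ~ y ⇔ ((W G v i x × W G v j y) ⊎ (W G v j x × W G v i y))
          adjacency x y N1x N1y = mk⇔ to from
            where
            from : (W G v i x × W G v j y) ⊎ (W G v j x × W G v i y) → x ~ y
            from (inj₁ (Wx , Wy)) = W-adjacent Wx Wy i≢j
            from (inj₂ (Wx , Wy)) = W-adjacent Wx Wy (i≢j ∘ ≡-sym)
            to : x ~ y → (W G v i x × W G v j y) ⊎ (W G v j x × W G v i y)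
            to x~y with W-union-member N1x | W-union-member N1y
            ... | inj₁ Wx | inj₂ Wy = inj₁ (Wx , Wy)
            ... | inj₂ Wx | inj₁ Wy = inj₂ (Wx , Wy)
            ... | inj₁ Wx | inj₁ Wy = ⊥-elim (W-independent Wx Wy (proj₂ occupied-j) (i≢j ∘ ≡-sym) x~y)
            ... | inj₂ Wx | inj₂ Wy = ⊥-elim (W-independent Wx Wy (proj₂ occupied-i) i≢j x~y)

      part-i : ¬ ThreeOccupied → ∃ λ i → ∃ λ j →
          SetEq (N 1) (λ x → W G v i x ⊎ W G v j x)
        × ((SetEq (N 1) (W G v i) ⊎ SetEq (N 1) (W G v j)) → DisjointUnionOfCliques G (N 1))
        × (¬ (SetEq (N 1) (W G v i) ⊎ SetEq (N 1) (W G v j)) → CompleteBipartite G (N 1) (W G v i) (W G v j))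
      part-i ¬three with two-classes-cover ¬three
      ... | i , j , cover = i , j , N-one≃W-union cover , [ one-class⇒cliques , one-class⇒cliques ]′
                            , two-classes⇒bipartite cover

      -- r is another vertex of K when j = 0, and a predecessor of t otherwise.
      blind-neighbour : ∀ j {t} → N j t → ∃ λ r → t ~ r
        × (∀ {y} → N (1 + j) y → y ~ t → ¬ y ~ r)
        × (∀ {w} → N (2 + j) w → ¬ w ~ r)
        × (∀ {y} → N (1 + j) y → y ≢ r)
      blind-neighbour zero N0t with N-zero⇒InK N0t
      ... | a , refl with other-index 2<ω a a
      ... | b , b≢a , _ = v b , v-adjacent a b (b≢a ∘ ≡-sym)
          , (λ N1y y~va y~vb → b≢a (one-neighbour-in-K (proj₁ (proj₂ (N-one⇒W N1y))) y~vb y~va))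
          , (λ N2w → N-nonadjacent K∋vb N2w ≤-refl ∘ ~-sym)
          , (λ N1y → N-distinct N1y K∋vb (λ ()))
        where
        K∋vb : N 0 (v b)
        K∋vb = InK⇒N-zero (b , refl)
      blind-neighbour (suc j) N1+jt with N-predecessor N1+jt
      ... | r , t~r , Nr = r , t~r , (λ N2+jy _ → N-nonadjacent Nr N2+jy ≤-refl ∘ ~-sym)
          , (λ N3+jw → N-nonadjacent Nr N3+jw (n≤1+n _) ∘ ~-sym)
          , (λ N2+jy → N-distinct N2+jy Nr (<⇒≢ℕ (n≤1+n _) ∘ ≡-sym))

      module _ (j : ℕ) where

        all-or-nothing : ∀ {a b c p} → N (2 + j) b → N (2 + j) c → a ~ b → a ~ c → b ~ c
          → N (1 + j) p → p ~ a → (p ~ b × p ~ c) ⊎ (¬ p ~ b × ¬ p ~ c)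
        all-or-nothing {b = b} {c} {p} N2b N2c a~b a~c b~c N1p p~a with dec G p b | dec G p c
        ... | yes p~b | _ = inj₁ (p~b , adjacent-to-third df a~b a~c b~c p~a p~b (N-step-distinct N1p N2c))
        ... | no _ | yes p~c = inj₁ (adjacent-to-third df a~c a~b (~-sym b~c) p~a p~c (N-step-distinct N1p N2b) , p~c)
        ... | no ¬p~b | no ¬p~c = inj₂ (¬p~b , ¬p~c)

        parent-triangle-impossible : ∀ {a b pa pb pc} → N (2 + j) a → N (2 + j) b
          → N (1 + j) pa → N (1 + j) pb → N (1 + j) pc → pa ~ pb → pa ~ pc → pb ~ pc
          → pa ~ a → pb ~ b → ¬ pa ~ b → ¬ pb ~ a → ¬ pc ~ a → ¬ pc ~ b → ⊥
        parent-triangle-impossible {pb = pb} {pc} N2a N2b N1pa N1pb N1pc pa~pb pa~pc pb~pc pa~a pb~b ¬pa~b ¬pb~a ¬pc~a ¬pc~b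
          with N-predecessor N1pa
        ... | t , pa~t , Nt with blind-neighbour j Nt
        ... | r , t~r , r-blind , r-blind₂ , _ with dec G t pb | dec G t pc
        ... | yes t~pb | _ = no-bull bf (~-sym pa~t) t~pb pa~pb (~-sym t~r) (~-sym pa~a) (N-gap Nt N2a)
                               (r-blind N1pa pa~t) (r-blind N1pb (~-sym t~pb)) ¬pb~a (r-blind₂ N2a ∘ ~-sym)
        ... | no _ | yes t~pc = no-bull bf (~-sym pa~t) t~pc pa~pc (~-sym t~r) (~-sym pa~a) (N-gap Nt N2a)
                                  (r-blind N1pa pa~t) (r-blind N1pc (~-sym t~pc)) ¬pc~a (r-blind₂ N2a ∘ ~-sym)
        ... | no ¬t~pb | no ¬t~pc = no-bull bf pa~pb pa~pc pb~pc (~-sym pa~t) (~-sym pb~b)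
                                      ¬pa~b (¬t~pb ∘ ~-sym) (¬t~pc ∘ ~-sym) ¬pc~b (N-gap Nt N2b)

        triangle-common-parent : ∀ {a b c} → N (2 + j) a → N (2 + j) b → N (2 + j) c → a ~ b → a ~ c → b ~ c
          → ∃ λ u → N (1 + j) u × u ~ a × u ~ b × u ~ c
        triangle-common-parent N2a N2b N2c a~b a~c b~c
          with N-predecessor N2a | N-predecessor N2b | N-predecessor N2c
        ... | pa , a~pa , N1pa | pb , b~pb , N1pb | pc , c~pc , N1pc
          with all-or-nothing N2b N2c a~b a~c b~c N1pa (~-sym a~pa)
             | all-or-nothing N2a N2c (~-sym a~b) b~c a~c N1pb (~-sym b~pb)
             | all-or-nothing N2a N2b (~-sym a~c) (~-sym b~c) a~b N1pc (~-sym c~pc)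
        ... | inj₁ (pa~b , pa~c) | _ | _ = pa , N1pa , ~-sym a~pa , pa~b , pa~c
        ... | inj₂ _ | inj₁ (pb~a , pb~c) | _ = pb , N1pb , pb~a , ~-sym b~pb , pb~c
        ... | inj₂ _ | inj₂ _ | inj₁ (pc~a , pc~b) = pc , N1pc , pc~a , pc~b , ~-sym c~pc
        ... | inj₂ (¬pa~b , ¬pa~c) | inj₂ (¬pb~a , ¬pb~c) | inj₂ (¬pc~a , ¬pc~b) =
          ⊥-elim (parent-triangle-impossible N2a N2b N1pa N1pb N1pc
            (pendants-adjacent bf a~b a~c b~c (~-sym a~pa) ¬pa~b ¬pa~c (~-sym b~pb) ¬pb~a ¬pb~c)
            (pendants-adjacent bf a~c a~b (~-sym b~c) (~-sym a~pa) ¬pa~c ¬pa~b (~-sym c~pc) ¬pc~a ¬pc~b)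
            (pendants-adjacent bf b~c (~-sym a~b) (~-sym a~c) (~-sym b~pb) ¬pb~c ¬pb~a (~-sym c~pc) ¬pc~b ¬pc~a)
            (~-sym a~pa) (~-sym b~pb) ¬pa~b ¬pb~a ¬pc~a ¬pc~b)

        triangle-neighbour-adjacent : ∀ {p q s y} → N (2 + j) p → N (2 + j) q → N (2 + j) s → p ~ q → p ~ s → q ~ s
          → N (2 + j) y → y ~ p → y ≢ q → y ~ q
        triangle-neighbour-adjacent {q = q} {y = y} N2p N2q N2s p~q p~s q~s N2y y~p y≢q with dec G y q
        ... | yes y~q = y~q
        ... | no ¬y~q with triangle-common-parent N2p N2q N2s p~q p~s q~s
        ... | u , N1u , u~p , u~q , _ with dec G y u
        ... | yes y~u = ⊥-elim (no-diamond df (~-sym u~p) (~-sym y~p) p~q (~-sym y~u) u~q ¬y~q y≢q)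
        ... | no ¬y~u with N-predecessor N1u
        ... | t , u~t , Nt = ⊥-elim (no-bull bf (~-sym u~p) p~q u~q y~p (~-sym u~t) (N-gap Nt N2p ∘ ~-sym)
                                 (¬y~u ∘ ~-sym) (¬y~q ∘ ~-sym) (N-gap Nt N2q ∘ ~-sym) (N-gap Nt N2y ∘ ~-sym))

        triangle-vertex-no-next : ∀ {x a b y} → N (2 + j) x → N (2 + j) a → N (2 + j) b → x ~ a → x ~ b → a ~ b
          → N (3 + j) y → ¬ x ~ y
        triangle-vertex-no-next {a = a} {y = y} N2x N2a N2b x~a x~b a~b N3y x~y
          with triangle-common-parent N2x N2a N2b x~a x~b a~b
        ... | u , N1u , u~x , u~a , _ with dec G y a
        ... | yes y~a = no-diamond df x~a x~y (~-sym u~x) (~-sym y~a) (~-sym u~a) (N-gap N1u N3y ∘ ~-sym)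
                          (N-distinct N3y N1u (<⇒≢ℕ (n≤1+n _) ∘ ≡-sym))
        ... | no ¬y~a with N-predecessor N1u
        ... | t , u~t , Nt = no-bull bf (~-sym u~x) x~a u~a (~-sym x~y) (~-sym u~t) (N-gap Nt N2x ∘ ~-sym)
                               (N-gap N1u N3y) (¬y~a ∘ ~-sym) (N-gap Nt N2a ∘ ~-sym)
                               (N-nonadjacent Nt N3y (n≤1+n _) ∘ ~-sym)

        module _ {C : Fin n → Set} (C-comp : IsComponent G (N (2 + j)) C) where

          root : Fin n
          root = proj₁ C-comp

          C∋root : C root
          C∋root = component-root C-comp

          module _ {p q s : Fin n} (Cp : C p) (Cq : C q) (Cs : C s) (p~q : p ~ q) (q~s : q ~ s) (p~s : p ~ s) where

            InT : Fin n → Set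
            InT w = w ≡ p ⊎ w ≡ q ⊎ w ≡ s

            InT? : ∀ w → Dec (InT w)
            InT? w = (w ≟ᶠ p) ⊎-dec (w ≟ᶠ q) ⊎-dec (w ≟ᶠ s)

            T-level : ∀ {w} → InT w → N (2 + j) w
            T-level (inj₁ refl) = component-⊆ C-comp Cp
            T-level (inj₂ (inj₁ refl)) = component-⊆ C-comp Cq
            T-level (inj₂ (inj₂ refl)) = component-⊆ C-comp Cs

            T-adjacent : ∀ {w w′} → InT w → InT w′ → w ≢ w′ → w ~ w′
            T-adjacent (inj₁ refl) (inj₁ refl) w≢w′ = ⊥-elim (w≢w′ refl)
            T-adjacent (inj₁ refl) (inj₂ (inj₁ refl)) _ = p~q
            T-adjacent (inj₁ refl) (inj₂ (inj₂ refl)) _ = p~s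
            T-adjacent (inj₂ (inj₁ refl)) (inj₁ refl) _ = ~-sym p~q
            T-adjacent (inj₂ (inj₁ refl)) (inj₂ (inj₁ refl)) w≢w′ = ⊥-elim (w≢w′ refl)
            T-adjacent (inj₂ (inj₁ refl)) (inj₂ (inj₂ refl)) _ = q~s
            T-adjacent (inj₂ (inj₂ refl)) (inj₁ refl) _ = ~-sym p~s
            T-adjacent (inj₂ (inj₂ refl)) (inj₂ (inj₁ refl)) _ = ~-sym q~s
            T-adjacent (inj₂ (inj₂ refl)) (inj₂ (inj₂ refl)) w≢w′ = ⊥-elim (w≢w′ refl)

            SeesT : Fin n → Set
            SeesT z = N (2 + j) z × (∀ w → InT w → w ≢ z → z ~ w)

            SeesT-spreads : ∀ {a y} → N (2 + j) y → a ~ y → SeesT a → SeesT y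
            SeesT-spreads {a} {y} N2y a~y (N2a , a-sees) = N2y , y-sees
              where
              y-sees : ∀ w → InT w → w ≢ y → y ~ w
              y-sees w Tw w≢y with w ≟ᶠ a
              ... | yes refl = ~-sym a~y
              ... | no w≢a with avoid-two _≟ᶠ_ InT (inj₁ refl) (inj₂ (inj₁ refl)) (inj₂ (inj₂ refl))
                                  (~⇒≢ p~q) (~⇒≢ p~s) (~⇒≢ q~s) w a
              ... | w′ , Tw′ , w′≢w , w′≢a =
                triangle-neighbour-adjacent N2a (T-level Tw) (T-level Tw′) (a-sees w Tw w≢a) (a-sees w′ Tw′ w′≢a)
                  (T-adjacent Tw Tw′ (w′≢w ∘ ≡-sym)) N2y (~-sym a~y) (w≢y ∘ ≡-sym)

            sees-T : ∀ {z} → C z → SeesT z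
            sees-T Cz = component-invariant SeesT C-comp SeesT-spreads Cp Cz
                          (T-level (inj₁ refl) , λ w Tw w≢p → T-adjacent (inj₁ refl) Tw (w≢p ∘ ≡-sym))

            complete-around-triangle : IsCompleteOn G C
            complete-around-triangle x y Cx Cy x≢y with dec G x y
            ... | yes x~y = x~y
            ... | no ¬x~y with InT? y | InT? x
            ... | yes Ty | _ = proj₂ (sees-T Cx) y Ty (x≢y ∘ ≡-sym)
            ... | no _ | yes Tx = ~-sym (proj₂ (sees-T Cy) x Tx x≢y)
            ... | no ¬Ty | no ¬Tx = ⊥-elim (no-diamond df p~q (sees Cx ¬Tx (inj₁ refl)) (sees Cy ¬Ty (inj₁ refl))
                                      (sees Cx ¬Tx (inj₂ (inj₁ refl))) (sees Cy ¬Ty (inj₂ (inj₁ refl))) ¬x~y x≢y)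
              where
              sees : ∀ {z w} → C z → ¬ InT z → InT w → w ~ z
              sees Cz ¬Tz Tw = ~-sym (proj₂ (sees-T Cz) _ Tw λ { refl → ¬Tz Tw })

            tri : HasTriangle G C
            tri = p , q , s , Cp , Cq , Cs , p~q , q~s , p~s

            complete : IsCompleteOn G C
            complete = complete-around-triangle

            C? : ∀ x → Dec (C x)
            C? x = map′ from to (N? (2 + j) x ×-dec ((x ≟ᶠ root) ⊎-dec dec G x root))
              where
              from : N (2 + j) x × (x ≡ root ⊎ x ~ root) → C x
              from (_ , inj₁ refl) = C∋root
              from (N2x , inj₂ x~r) = component-closed C-comp C∋root N2x (~-sym x~r)
              to : C x → N (2 + j) x × (x ≡ root ⊎ x ~ root)
              to Cx with x ≟ᶠ root
              ... | yes x≡r = component-⊆ C-comp Cx , inj₁ x≡r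
              ... | no x≢r = component-⊆ C-comp Cx , inj₂ (complete x root Cx C∋root x≢r)

            Full : Fin n → Set
            Full u = ∀ z → C z → u ~ z

            SeesOnly : Fin n → Fin n → Set
            SeesOnly u z = u ~ z × (∀ z′ → C z′ → z′ ≢ z → ¬ u ~ z′)

            SeesOnly? : ∀ u z → Dec (SeesOnly u z)
            SeesOnly? u z = dec G u z ×-dec all? λ z′ → C? z′ →-dec ¬? (z′ ≟ᶠ z) →-dec ¬? (dec G u z′)

            two-neighbours⇒full : ∀ {u x y} → N (1 + j) u → C x → C y → x ≢ y → u ~ x → u ~ y → Full u
            two-neighbours⇒full {x = x} {y} N1u Cx Cy x≢y u~x u~y z Cz with z ≟ᶠ x | z ≟ᶠ y
            ... | yes refl | _ = u~x
            ... | no _ | yes refl = u~y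
            ... | no z≢x | no z≢y = adjacent-to-third df (complete x y Cx Cy x≢y) (complete x z Cx Cz (z≢x ∘ ≡-sym))
                                      (complete y z Cy Cz (z≢y ∘ ≡-sym)) u~x u~y
                                      (N-step-distinct N1u (component-⊆ C-comp Cz))

            full-or-sees-only : ∀ {u z} → N (1 + j) u → C z → u ~ z → Full u ⊎ SeesOnly u z
            full-or-sees-only {u} {z} N1u Cz u~z with any? (λ z′ → C? z′ ×-dec ¬? (z′ ≟ᶠ z) ×-dec dec G u z′)
            ... | yes (z′ , Cz′ , z′≢z , u~z′) =
                  inj₁ (two-neighbours⇒full N1u Cz Cz′ (z′≢z ∘ ≡-sym) u~z u~z′)
            ... | no none = inj₂ (u~z , λ z′ Cz′ z′≢z u~z′ → none (z′ , Cz′ , z′≢z , u~z′))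

            full-adjacent : ∀ {u u′} → Full u → Full u′ → u ≢ u′ → u ~ u′
            full-adjacent {u} {u′} full full′ u≢u′ with dec G u u′
            ... | yes u~u′ = u~u′
            ... | no ¬u~u′ =
                  ⊥-elim (no-diamond df p~q (~-sym (full _ Cp)) (~-sym (full′ _ Cp)) (~-sym (full _ Cq))
                            (~-sym (full′ _ Cq)) ¬u~u′ u≢u′)

            full-parent : ∃ λ u → N (1 + j) u × Full u
            full-parent
              with triangle-common-parent (T-level (inj₁ refl)) (T-level (inj₂ (inj₁ refl))) (T-level (inj₂ (inj₂ refl)))
                     p~q p~s q~s
            ... | u , N1u , u~p , u~q , _ = u , N1u , two-neighbours⇒full N1u Cp Cq (~⇒≢ p~q) u~p u~q

            below-neighbour-level : ∀ {w x} → Below (2 + j) w → C x → w ~ x → N (1 + j) w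
            below-neighbour-level (m , m<2+j , Nmw) Cx w~x with m ℕ.≟ 1 + j
            ... | yes refl = Nmw
            ... | no m≢1+j =
                  ⊥-elim (N-nonadjacent Nmw (component-⊆ C-comp Cx) (s≤s (≤∧≢⇒< (≤-pred m<2+j) m≢1+j)) w~x)

            sees-only⇒sees-grandparent : ∀ {w₀ t′ u z} → Full w₀ → N j t′ → w₀ ~ t′
              → N (1 + j) u → C z → SeesOnly u z → t′ ~ u
            sees-only⇒sees-grandparent {w₀} {t′} {u} {z} full Nt′ w₀~t′ N1u Cz (u~z , only) with other-in tri z z
            ... | a , Ca , a≢z , _ with dec G t′ u
            ... | yes t′~u = t′~u
            ... | no ¬t′~u = ⊥-elim (no-bull bf (~-sym (full z Cz)) z~a (full a Ca) u~z (~-sym w₀~t′)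
                                       (N-gap Nt′ N2z ∘ ~-sym) ¬w₀~u (only a Ca a≢z ∘ ~-sym) (N-gap Nt′ N2a ∘ ~-sym)
                                       (¬t′~u ∘ ~-sym))
              where
              N2z : N (2 + j) z
              N2z = component-⊆ C-comp Cz
              N2a : N (2 + j) _
              N2a = component-⊆ C-comp Ca
              z~a : z ~ _
              z~a = complete z _ Cz Ca (a≢z ∘ ≡-sym)
              ¬w₀~u : ¬ w₀ ~ u
              ¬w₀~u w₀~u = no-diamond df (full z Cz) w₀~u (full _ Ca) (~-sym u~z) z~a (only _ Ca a≢z)
                             (N-step-distinct N1u N2a)

            finish : ∀ {k} (X : Fin n → Set) → (∀ x → Dec (X x)) → (∀ {x} → X x → C x)
              → (c : Fin n → Fin k) → ω ≤ k → ProperOn (λ y → Below (2 + j) y ⊎ X y) c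
              → (∀ {w x} → Below (2 + j) w → C x → ¬ X x → w ~ x → Full w)
              → Colorable G (λ x → Below (2 + j) x ⊎ C x) k
            finish X X? X⊆C c ω≤k c-proper full-outside
              with greedy-extend (proj₂ mc) ω≤k (λ y → Below? (2 + j) y ⊎-dec X? y) (λ y → C? y ×-dec ¬? (X? y))
                     c-proper clique-nbhd
              where
              full-or-C : ∀ {x y} → C x → ¬ X x → (Below (2 + j) y ⊎ X y) ⊎ (C y × ¬ X y) → x ~ y
                → Full y ⊎ C y
              full-or-C Cx ¬Xx (inj₁ (inj₁ By)) x~y = inj₁ (full-outside By Cx ¬Xx (~-sym x~y))
              full-or-C _ _ (inj₁ (inj₂ Xy)) _ = inj₂ (X⊆C Xy)
              full-or-C _ _ (inj₂ (Cy , _)) _ = inj₂ Cy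
              pairwise : ∀ {y z} → Full y ⊎ C y → Full z ⊎ C z → y ≢ z → y ~ z
              pairwise (inj₁ full-y) (inj₁ full-z) y≢z = full-adjacent full-y full-z y≢z
              pairwise (inj₁ full-y) (inj₂ Cz) _ = full-y _ Cz
              pairwise (inj₂ Cy) (inj₁ full-z) _ = ~-sym (full-z _ Cy)
              pairwise (inj₂ Cy) (inj₂ Cz) y≢z = complete _ _ Cy Cz y≢z
              clique-nbhd : ∀ x → C x × ¬ X x
                → NeighbourhoodCliqueIn (λ y → (Below (2 + j) y ⊎ X y) ⊎ (C y × ¬ X y)) x
              clique-nbhd x (Cx , ¬Xx) y z Uy Uz x~y x~z = pairwise (full-or-C Cx ¬Xx Uy x~y) (full-or-C Cx ¬Xx Uz x~z)
            ... | c′ , c′-proper , _ = c′ , proper-mono cover c′-proper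
              where
              cover : ∀ y → Below (2 + j) y ⊎ C y → (Below (2 + j) y ⊎ X y) ⊎ (C y × ¬ X y)
              cover y (inj₁ By) = inj₁ (inj₁ By)
              cover y (inj₂ Cy) with X? y
              ... | yes Xy = inj₁ (inj₂ Xy)
              ... | no ¬Xy = inj₂ (Cy , ¬Xy)

            module _ {u₀ t : Fin n} (full₀ : Full u₀) (Nt : N j t) (u₀~t : u₀ ~ t) where

              sees-only⇒sees-t : ∀ {u z} → N (1 + j) u → C z → SeesOnly u z → t ~ u
              sees-only⇒sees-t = sees-only⇒sees-grandparent full₀ Nt u₀~t

              sees-only-unique : ∀ {u u′ z z′} → N (1 + j) u → N (1 + j) u′ → C z → C z′
                → SeesOnly u z → SeesOnly u′ z′ → z′ ≡ z
              sees-only-unique {u} {u′} {z} {z′} N1u N1u′ Cz Cz′ only only′ with z′ ≟ᶠ z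
              ... | yes z′≡z = z′≡z
              ... | no z′≢z with other-in tri z z′ | blind-neighbour j Nt
              ... | a , Ca , a≢z , a≢z′ | r , t~r , r-blind , r-blind₂ , _ =
                ⊥-elim (no-bull bf t~u t~u′ u~u′ (~-sym t~r) (~-sym (proj₁ only)) (N-gap Nt N2z)
                          (r-blind N1u (~-sym t~u)) (r-blind N1u′ (~-sym t~u′)) (proj₂ only′ z Cz (z′≢z ∘ ≡-sym))
                          (r-blind₂ N2z ∘ ~-sym))
                where
                N2z : N (2 + j) z
                N2z = component-⊆ C-comp Cz
                t~u : t ~ u
                t~u = sees-only⇒sees-t N1u Cz only
                t~u′ : t ~ u′
                t~u′ = sees-only⇒sees-t N1u′ Cz′ only′
                u~u′ : u ~ u′
                u~u′ = pendants-adjacent bf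
                         (complete z z′ Cz Cz′ (z′≢z ∘ ≡-sym)) (complete z a Cz Ca (a≢z ∘ ≡-sym))
                         (complete z′ a Cz′ Ca (a≢z′ ∘ ≡-sym))
                         (proj₁ only) (proj₂ only z′ Cz′ z′≢z) (proj₂ only a Ca a≢z)
                         (proj₁ only′) (proj₂ only′ z Cz (z′≢z ∘ ≡-sym)) (proj₂ only′ a Ca a≢z′)

              t-sees-full : ∀ {u xs u₁} → N (1 + j) u → C xs → SeesOnly u xs
                → N (1 + j) u₁ → Full u₁ → t ~ u₁
              t-sees-full {u} {xs} {u₁} N1u Cxs only N1u₁ full₁ with u₁ ≟ᶠ u₀ | dec G t u₁
              ... | yes refl | _ = ~-sym u₀~t
              ... | no _ | yes t~u₁ = t~u₁
              ... | no u₁≢u₀ | no ¬t~u₁ with N-predecessor N1u₁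
              ... | t₁ , u₁~t₁ , Nt₁ = ⊥-elim contradiction
                where
                N2xs : N (2 + j) xs
                N2xs = component-⊆ C-comp Cxs
                t~u : t ~ u
                t~u = sees-only⇒sees-t N1u Cxs only
                t₁~u : t₁ ~ u
                t₁~u = sees-only⇒sees-grandparent full₁ Nt₁ u₁~t₁ N1u Cxs only
                u₀~u₁ : u₀ ~ u₁
                u₀~u₁ = full-adjacent full₀ full₁ (u₁≢u₀ ∘ ≡-sym)
                ¬t₁~u₀ : ¬ t₁ ~ u₀
                ¬t₁~u₀ t₁~u₀ = N-gap Nt₁ N2xs (adjacent-to-third df u₀~u₁ (full₀ xs Cxs) (full₁ xs Cxs) t₁~u₀
                                                 (~-sym u₁~t₁) (N-distinct Nt₁ N2xs (<⇒≢ℕ (n≤1+n _))))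
                t~t₁ : t ~ t₁
                t~t₁ with dec G t t₁
                ... | yes t~t₁ = t~t₁
                ... | no ¬t~t₁ = ⊥-elim (no-bull bf u₀~u₁ (full₀ xs Cxs) (full₁ xs Cxs) (~-sym u₀~t) (~-sym u₁~t₁)
                                           (¬t₁~u₀ ∘ ~-sym) (¬t~u₁ ∘ ~-sym) (N-gap Nt N2xs ∘ ~-sym)
                                           (N-gap Nt₁ N2xs ∘ ~-sym) ¬t~t₁)
                contradiction : ⊥
                contradiction with blind-neighbour j Nt
                ... | r , t~r , r-blind , r-blind₂ , r≢ with dec G t₁ r
                ... | yes t₁~r = no-diamond df t~t₁ t~r t~u t₁~r t₁~u (r-blind N1u (~-sym t~u) ∘ ~-sym)
                                   (r≢ N1u ∘ ≡-sym)
                ... | no ¬t₁~r = no-bull bf t~u t~t₁ (~-sym t₁~u) (~-sym t~r) (~-sym (proj₁ only)) (N-gap Nt N2xs)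
                                   (r-blind N1u (~-sym t~u)) ¬t₁~r (N-gap Nt₁ N2xs) (r-blind₂ N2xs ∘ ~-sym)

              -- If some vertex one level down sees only the vertex xs of C, every neighbour of xs below sees t,
              -- so xs can take the colour of t; the other vertices of C then only have full neighbours below.
              extend-colouring : ∀ {k} → Colorable G (Below (2 + j)) k → Colorable G (λ x → Below (2 + j) x ⊎ C x) k
              extend-colouring (c , c-proper) with any? (λ u → any? λ z → N? (1 + j) u ×-dec C? z ×-dec SeesOnly? u z)
              ... | no none = finish (λ _ → ⊥) (λ _ → no λ ()) ⊥-elim c (K-needs-colours c-proper)
                                (proper-mono (λ { y (inj₁ By) → By }) c-proper) all-full
                where
                all-full : ∀ {w x} → Below (2 + j) w → C x → ¬ ⊥ → w ~ x → Full w
                all-full Bw Cx _ w~x with full-or-sees-only (below-neighbour-level Bw Cx w~x) Cx w~x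
                ... | inj₁ full = full
                ... | inj₂ only = ⊥-elim (none (_ , _ , below-neighbour-level Bw Cx w~x , Cx , only))
              ... | yes (u , xs , N1u , Cxs , only) =
                finish (_≡ xs) (_≟ᶠ xs) (λ { refl → Cxs }) (c [ xs ≔ c t ]) (K-needs-colours c-proper)
                  (proj₁ (colour-vertex (c t) c-proper (N⇒¬Below (component-⊆ C-comp Cxs)) t-colour-free))
                  full-elsewhere
                where
                t-colour-free : ∀ y → Below (2 + j) y → xs ~ y → c y ≢ c t
                t-colour-free y By xs~y with below-neighbour-level By Cxs (~-sym xs~y)
                ... | N1y with full-or-sees-only N1y Cxs (~-sym xs~y)
                ... | inj₁ full = c-proper t y (j , n≤1+n _ , Nt) By (t-sees-full N1u Cxs only N1y full) ∘ ≡-sym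
                ... | inj₂ only′ = c-proper t y (j , n≤1+n _ , Nt) By (sees-only⇒sees-t N1y Cxs only′) ∘ ≡-sym
                full-elsewhere : ∀ {w x} → Below (2 + j) w → C x → x ≢ xs → w ~ x → Full w
                full-elsewhere Bw Cx x≢xs w~x with full-or-sees-only (below-neighbour-level Bw Cx w~x) Cx w~x
                ... | inj₁ full = full
                ... | inj₂ only′ =
                      ⊥-elim (x≢xs (sees-only-unique N1u (below-neighbour-level Bw Cx w~x) Cxs Cx only only′))

          triangle⇒complete : HasTriangle G C → IsCompleteOn G C
          triangle⇒complete (_ , _ , _ , Cp , Cq , Cs , p~q , q~s , p~s) = complete-around-triangle Cp Cq Cs p~q q~s p~s

          complete-or-triangle-free : IsCompleteOn G C ⊎ TriangleFreeOn G C
          complete-or-triangle-free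
            with any? (λ a → any? λ b → N? (2 + j) a ×-dec N? (2 + j) b
                                     ×-dec dec G root a ×-dec dec G root b ×-dec dec G a b)
          ... | yes (a , b , N2a , N2b , r~a , r~b , a~b) = inj₁ (triangle⇒complete
                (root , a , b , C∋root , component-closed C-comp C∋root N2a r~a , component-closed C-comp C∋root N2b r~b
                , r~a , a~b , r~b))
          ... | no no-triangle-at-root = inj₂ λ tri →
                let a , b , Ca , Cb , a≢r , b≢r , b≢a = two-others tri root
                    complete = triangle⇒complete tri
                in no-triangle-at-root (a , b , component-⊆ C-comp Ca , component-⊆ C-comp Cb
                     , complete root a C∋root Ca (a≢r ∘ ≡-sym) , complete root b C∋root Cb (b≢r ∘ ≡-sym)
                     , complete a b Ca Cb (b≢a ∘ ≡-sym))

          triangle⇒no-next-neighbours : HasTriangle G C → ∀ x y → C x → N (3 + j) y → ¬ x ~ y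
          triangle⇒no-next-neighbours tri x y Cx N3y =
            let a , b , Ca , Cb , a≢x , b≢x , b≢a = two-others tri x
                complete = triangle⇒complete tri
            in triangle-vertex-no-next (component-⊆ C-comp Cx) (component-⊆ C-comp Ca) (component-⊆ C-comp Cb)
                 (complete x a Cx Ca (a≢x ∘ ≡-sym)) (complete x b Cx Cb (b≢x ∘ ≡-sym))
                 (complete a b Ca Cb (b≢a ∘ ≡-sym)) N3y


          extend-to-component : HasTriangle G C → ∀ {k}
            → Colorable G (Below (2 + j)) k → Colorable G (λ x → Below (2 + j) x ⊎ C x) k
          extend-to-component (_ , _ , _ , Cp , Cq , Cs , p~q , q~s , p~s) with full-parent Cp Cq Cs p~q q~s p~s
          ... | u₀ , N1u₀ , full₀ with N-predecessor N1u₀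
          ... | t , u₀~t , Nt = extend-colouring Cp Cq Cs p~q q~s p~s full₀ Nt u₀~t

lemma3p1 : ∀ {n ω : ℕ} (G : Graph (Fin n)) (v : Fin ω → Fin n)
    → Connected G → BullFree G → DiamondFree G
    → 2 < ω → IsMaxClique G v
    → IsoToSubgraphOf G (Kc ω □ Kc 2)
      ⊎ ( -- (i)
          (∃ λ i → ∃ λ j →
              SetEq (Nb G v 1) (λ x → W G v i x ⊎ W G v j x)
            × ((SetEq (Nb G v 1) (W G v i) ⊎ SetEq (Nb G v 1) (W G v j))
                 → DisjointUnionOfCliques G (Nb G v 1))
            × (¬ (SetEq (Nb G v 1) (W G v i) ⊎ SetEq (Nb G v 1) (W G v j))
                 → CompleteBipartite G (Nb G v 1) (W G v i) (W G v j)))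
          -- (ii)
        × (∀ i → 2 ≤ i → ∀ C → IsComponent G (Nb G v i) C
             → IsCompleteOn G C ⊎ TriangleFreeOn G C)
          -- (iii)
        × (∀ i → 2 ≤ i → ∀ C → IsComponent G (Nb G v i) C → HasTriangle G C
             → ∀ x y → C x → Nb G v (suc i) y → ¬ E G x y)
          -- (iv)
        × (∀ i → 2 ≤ i → ∀ C → IsComponent G (Nb G v i) C → HasTriangle G C
             → ∀ k
             → Colorable G (λ x → ∃ λ m → m < i × Nb G v m x) k
             → Colorable G (λ x → (∃ λ m → m < i × Nb G v m x) ⊎ C x) k))
lemma3p1 G v conn bf df 2<ω mc with Structure.ThreeOccupied? G v bf df mc 2<ω
... | yes three = inj₁ (Structure.three-occupied⇒embeds G v bf df mc 2<ω conn three)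
... | no ¬three = inj₂ (part-i ¬three , part-ii , part-iii , part-iv)
  where
  open Structure G v bf df mc 2<ω
  part-ii : ∀ i → 2 ≤ i → ∀ C → IsComponent G (Nb G v i) C → IsCompleteOn G C ⊎ TriangleFreeOn G C
  part-ii (suc (suc j)) (s≤s (s≤s _)) C comp = complete-or-triangle-free j comp
  part-iii : ∀ i → 2 ≤ i → ∀ C → IsComponent G (Nb G v i) C → HasTriangle G C
    → ∀ x y → C x → Nb G v (suc i) y → ¬ E G x y
  part-iii (suc (suc j)) (s≤s (s≤s _)) C comp = triangle⇒no-next-neighbours j comp
  part-iv : ∀ i → 2 ≤ i → ∀ C → IsComponent G (Nb G v i) C → HasTriangle G C
    → ∀ k → Colorable G (Below G v i) k → Colorable G (λ x → Below G v i x ⊎ C x) k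
  part-iv (suc (suc j)) (s≤s (s≤s _)) C comp tri _ = extend-to-component j comp tri
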